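{- For $n\ge1$, $$\sum_{\sigma\in\mathfrak S_{n+1}}(-1)^{{\rm des}(\sigma)}\Bigl(\frac{\beta}{2}\Bigr)^{{\rm LRmin}(\sigma)+{\rm RLmin}(\sigma)-2}=\begin{cases}(-1)^{\frac n2}\sum_{\sigma\in\mathfrak S^a_n}\beta^{{\rm RLmin}(\sigma)},& n\text{ even},\\ 0,& n\text{ odd},\end{cases}$$ where $\mathfrak S^a_n$ is the set of down-up permutations of $[n]$.
   Context: $\mathfrak S_m$ is the set of permutations $\sigma=\sigma_1\cdots\sigma_m$ of $[m]$. A permutation is down-up if $\sigma_1>\sigma_2<\sigma_3>\sigma_4<\cdots$. ${\rm des}(\sigma)$ is the number of $1\le i<m$ with $\sigma_i>\sigma_{i+1}$; ${\rm LRmin}(\sigma)$ (resp. ${\rm RLmin}(\sigma)$) is the number of entries smaller than all entries to their left (resp. right). -}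

module Defs where

open import Data.Bool using (Bool; true; false; _∧_; if_then_else_)
open import Data.Nat using (ℕ; zero; suc; _∸_; _<ᵇ_; _≟_)
import Data.Nat as ℕ
open import Data.List using (List; []; _∷_; map; concatMap; filter; reverse; upTo)
open import Data.List.Relation.Unary.Unique.DecPropositional _≟_ using (unique?)
open import Data.Rational using (ℚ; 0ℚ; 1ℚ; _+_; _*_; -_)

words : ℕ → ℕ → List (List ℕ)
words m zero    = [] ∷ []
words m (suc k) = concatMap (λ w → map (λ i → suc i ∷ w) (upTo m)) (words m k)

-- 𝔖_m : permutations σ = σ₁⋯σ_m of [m] = {1,…,m}, in one-line notation
-- (words of length m over [m] with pairwise distinct letters).
Perms : ℕ → List (List ℕ)
Perms m = filter unique? (words m m)

des : List ℕ → ℕ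
des []           = 0
des (x ∷ [])     = 0
des (x ∷ y ∷ r)  = (if y <ᵇ x then 1 else 0) ℕ.+ des (y ∷ r)

-- number of entries smaller than all entries to their left, given the
-- minimum m of the entries already seen
lrminFrom : ℕ → List ℕ → ℕ
lrminFrom m []      = 0
lrminFrom m (x ∷ r) = if x <ᵇ m then suc (lrminFrom x r) else lrminFrom m r

LRmin : List ℕ → ℕ
LRmin []      = 0
LRmin (x ∷ r) = suc (lrminFrom x r)

RLmin : List ℕ → ℕ
RLmin σ = LRmin (reverse σ)

mutual
  isDownUp : List ℕ → Bool
  isDownUp []          = true
  isDownUp (x ∷ [])    = true
  isDownUp (x ∷ y ∷ r) = (y <ᵇ x) ∧ isUpDown (y ∷ r)

  isUpDown : List ℕ → Bool
  isUpDown []          = true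
  isUpDown (x ∷ [])    = true
  isUpDown (x ∷ y ∷ r) = (x <ᵇ y) ∧ isDownUp (y ∷ r)

DownUpPerms : ℕ → List (List ℕ)
DownUpPerms n = filter (λ σ → Data.Bool._≟_ (isDownUp σ) true) (Perms n)
  where import Data.Bool

∑ : {A : Set} → List A → (A → ℚ) → ℚ
∑ []      f = 0ℚ
∑ (a ∷ l) f = f a + ∑ l f

pow : ℚ → ℕ → ℚ
pow q zero    = 1ℚ
pow q (suc k) = q * pow q k

{-# OPTIONS --safe #-}
-- Cut each permutation of [n+1] at its least letter, σ = A 1 B. The descents, left-to-right and
-- right-to-left minima and the down-up property of σ are read off from those of A and B, so each
-- sum involved satisfies a recurrence f(n+1) = Σ_i C(n,i) u(i) v(n−i): a product of exponential
-- generating functions. With t = β/2 the left-hand side becomes s(n) = Σ_i C(n,i) (−1)^[i>0] a(i) b(n−i),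
-- where a, b are the signed sums of t^LRmin and t^RLmin. Expanding a and b once more, the two
-- t-terms combine to β c⁺, where c⁺(m) is the signed descent sum over 𝔖_m (m ≥ 1), itself
-- sin⁽ᵐ⁾(0) times the Euler number E_m. So s(n+1) = −β Σ_i C(n,i) c⁺(i) s(n−i), which is also the
-- recurrence of cos⁽ⁿ⁾(0) D(n) for D(n) the sum of β^RLmin over down-up permutations of [n];
-- hence s(n) = cos⁽ⁿ⁾(0) D(n) by strong induction.
module Submission where

open import Algebra.Bundles using (CommutativeMonoid)
import Algebra.Properties.CommutativeSemigroup as CommutativeSemigroupProperties
open import Data.Bool using (Bool; true; false; _∧_; if_then_else_; T)
import Data.Bool as Bool
open import Data.Bool.Properties using (T-≡)
open import Data.Empty using (⊥; ⊥-elim)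
open import Data.List using (List; []; _∷_; _++_; [_]; map; concatMap; filter; reverse; length; null; upTo)
import Data.List.Properties as List
open import Data.List.Membership.Propositional using (_∈_; _∉_; find; lose)
open import Data.List.Membership.Propositional.Properties
  using (∈-++⁻; ∈-++⁺ˡ; ∈-++⁺ʳ; ∈-map⁻; ∈-map⁺; ∈-concatMap⁻; ∈-concatMap⁺; ∈-∃++; ∈-filter⁺; ∈-filter⁻; ∈-upTo⁺; ∈-upTo⁻)
open import Data.List.Membership.Propositional.Properties.WithK using (unique∧set⇒bag)
open import Data.List.Relation.Binary.BagAndSetEquality using (∼bag⇒↭)
open import Data.List.Relation.Binary.Permutation.Propositional as ↭ using (_↭_)
open import Data.List.Relation.Binary.Subset.Propositional using (_⊆_)
open import Data.List.Relation.Unary.All using ([]; _∷_)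
open import Data.List.Relation.Unary.All.Properties using (¬Any⇒All¬; All¬⇒¬Any)
open import Data.List.Relation.Unary.AllPairs using ([]; _∷_)
open import Data.List.Relation.Unary.Any using (here; there)
import Data.List.Relation.Unary.Any.Properties as Any
open import Data.List.Relation.Unary.Unique.Propositional using (Unique)
import Data.List.Relation.Unary.Unique.Propositional.Properties as Unique
open import Data.Nat using (ℕ; zero; suc; _<_; _≤_; _≥_; _<ᵇ_; _∸_; _≟_; z≤n; s≤s)
import Data.Nat as ℕ
open import Data.Nat.Induction using (<-rec)
import Data.Nat.Properties as ℕ
open import Data.List.Membership.DecPropositional _≟_ using (_∈?_)
open import Data.List.Relation.Unary.Unique.DecPropositional _≟_ using (unique?)
open import Data.Product using (Σ; ∃-syntax; _×_; _,_; proj₁; proj₂; map₁; map₂)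
open import Data.Rational using (ℚ; 0ℚ; 1ℚ; ½; _+_; _*_; -_)
open import Data.Rational.Properties
  using (+-0-commutativeMonoid; +-comm; +-assoc; +-identityˡ; +-identityʳ;
         *-comm; *-assoc; *-identityˡ; *-identityʳ; *-zeroˡ; *-zeroʳ; *-distribˡ-+; *-distribʳ-+)
open import Data.Rational.Solver using (module +-*-Solver)
open import Data.Sum using (_⊎_; inj₁; inj₂)
open import Data.Unit using (⊤; tt)
open import Function using (_∘_; mk⇔; Equivalence)
open import Relation.Binary using (_Preserves_⟶_; tri<; tri≈; tri>)
open import Relation.Binary.PropositionalEquality hiding ([_])
open import Relation.Nullary using (¬_; yes; no)
open import Relation.Nullary.Decidable using (¬?)

open import Defs

open +-*-Solver
open CommutativeSemigroupProperties (CommutativeMonoid.commutativeSemigroup +-0-commutativeMonoid)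
  using () renaming (interchange to +-interchange)

-- Binomial convolution and the sine and cosine recurrences

strong-induction-≡ : {A : Set} {f g : ℕ → A} → f 0 ≡ g 0 →
  (∀ n → (∀ m → m ≤ n → f m ≡ g m) → f (suc n) ≡ g (suc n)) → ∀ n → f n ≡ g n
strong-induction-≡ {f = f} {g = g} base step = <-rec (λ n → f n ≡ g n) λ where
  zero    _  → base
  (suc n) ih → step n (λ m m≤n → ih (s≤s m≤n))

-- conv n F = Σ_{i+j=n} (n choose i) F i j, computed by Pascal's rule: the
-- coefficient of xⁿ/n! in a product of exponential generating functions.
conv : ℕ → (ℕ → ℕ → ℚ) → ℚ
conv zero    F = F 0 0
conv (suc n) F = conv n (λ i j → F (suc i) j) + conv n (λ i j → F i (suc j))

conv-cong : ∀ n (F G : ℕ → ℕ → ℚ) → (∀ i j → i ℕ.+ j ≡ n → F i j ≡ G i j) → conv n F ≡ conv n G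
conv-cong zero    F G F≡G = F≡G 0 0 refl
conv-cong (suc n) F G F≡G = cong₂ _+_
  (conv-cong n _ _ (λ i j i+j≡n → F≡G (suc i) j (cong suc i+j≡n)))
  (conv-cong n _ _ (λ i j i+j≡n → F≡G i (suc j) (trans (ℕ.+-suc i j) (cong suc i+j≡n))))

conv-cong′ : ∀ n (F G : ℕ → ℕ → ℚ) → (∀ i j → F i j ≡ G i j) → conv n F ≡ conv n G
conv-cong′ n F G F≡G = conv-cong n F G (λ i j _ → F≡G i j)

conv-+ : ∀ n (F G : ℕ → ℕ → ℚ) → conv n (λ i j → F i j + G i j) ≡ conv n F + conv n G
conv-+ zero    F G = refl
conv-+ (suc n) F G = trans
  (cong₂ _+_ (conv-+ n (λ i j → F (suc i) j) (λ i j → G (suc i) j)) (conv-+ n (λ i j → F i (suc j)) (λ i j → G i (suc j))))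
  (+-interchange (conv n (λ i j → F (suc i) j)) (conv n (λ i j → G (suc i) j))
                 (conv n (λ i j → F i (suc j))) (conv n (λ i j → G i (suc j))))

conv-* : ∀ n k (F : ℕ → ℕ → ℚ) → conv n (λ i j → k * F i j) ≡ k * conv n F
conv-* zero    k F = refl
conv-* (suc n) k F = trans (cong₂ _+_ (conv-* n k _) (conv-* n k _)) (sym (*-distribˡ-+ k _ _))

conv-0 : ∀ n → conv n (λ _ _ → 0ℚ) ≡ 0ℚ
conv-0 zero    = refl
conv-0 (suc n) = cong₂ _+_ (conv-0 n) (conv-0 n)

conv-neg : ∀ n (F : ℕ → ℕ → ℚ) → conv n (λ i j → - F i j) ≡ - conv n F
conv-neg n F = begin
  conv n (λ i j → - F i j)        ≡⟨ conv-cong′ n _ _ (λ i j → solve 1 (λ x → :- x := con (- 1ℚ) :* x) refl (F i j)) ⟩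
  conv n (λ i j → - 1ℚ * F i j)   ≡⟨ conv-* n (- 1ℚ) F ⟩
  - 1ℚ * conv n F                 ≡⟨ solve 1 (λ x → con (- 1ℚ) :* x := :- x) refl (conv n F) ⟩
  - conv n F                      ∎
  where open ≡-Reasoning

conv-comm : ∀ n (F : ℕ → ℕ → ℚ) → conv n (λ i j → F j i) ≡ conv n F
conv-comm zero    F = refl
conv-comm (suc n) F = trans
  (cong₂ _+_ (conv-comm n (λ i j → F i (suc j))) (conv-comm n (λ i j → F (suc i) j)))
  (+-comm (conv n (λ i j → F i (suc j))) (conv n (λ i j → F (suc i) j)))

conv-assoc : ∀ n (F : ℕ → ℕ → ℕ → ℚ) →
  conv n (λ i j → conv i (λ a b → F a b j)) ≡ conv n (λ a k → conv k (λ b j → F a b j))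
conv-assoc zero    F = refl
conv-assoc (suc n) F = begin
    conv n (λ i j → conv i (λ a b → F (suc a) b j) + conv i (λ a b → F a (suc b) j)) + T₃
  ≡⟨ cong (_+ T₃) (conv-+ n (λ i j → conv i (λ a b → F (suc a) b j)) (λ i j → conv i (λ a b → F a (suc b) j))) ⟩
    (T₁ + T₂) + T₃
  ≡⟨ cong₂ _+_ (cong₂ _+_ (conv-assoc n (λ a b j → F (suc a) b j)) (conv-assoc n (λ a b j → F a (suc b) j)))
               (conv-assoc n (λ a b j → F a b (suc j))) ⟩
    (U₁ + U₂) + U₃
  ≡⟨ +-assoc U₁ U₂ U₃ ⟩
    U₁ + (U₂ + U₃)
  ≡⟨ cong (U₁ +_) (sym (conv-+ n (λ a k → conv k (λ b j → F a (suc b) j)) (λ a k → conv k (λ b j → F a b (suc j))))) ⟩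
    U₁ + conv n (λ a k → conv k (λ b j → F a (suc b) j) + conv k (λ b j → F a b (suc j)))
  ∎
  where
  open ≡-Reasoning
  T₁ = conv n (λ i j → conv i (λ a b → F (suc a) b j))
  T₂ = conv n (λ i j → conv i (λ a b → F a (suc b) j))
  T₃ = conv n (λ i j → conv i (λ a b → F a b (suc j)))
  U₁ = conv n (λ a k → conv k (λ b j → F (suc a) b j))
  U₂ = conv n (λ a k → conv k (λ b j → F a (suc b) j))
  U₃ = conv n (λ a k → conv k (λ b j → F a b (suc j)))

conv-exchange : ∀ n (F : ℕ → ℕ → ℕ → ℚ) →
  conv n (λ i k → conv k (λ p q → F i p q)) ≡ conv n (λ i k → conv k (λ p q → F p i q))
conv-exchange n F = begin
  conv n (λ i k → conv k (λ p q → F i p q))   ≡⟨ conv-assoc n F ⟨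
  conv n (λ m q → conv m (λ i p → F i p q))   ≡⟨ conv-cong′ n _ _ (λ m q → conv-comm m (λ i p → F i p q)) ⟨
  conv n (λ m q → conv m (λ p i → F i p q))   ≡⟨ conv-assoc n (λ p i q → F i p q) ⟩
  conv n (λ i k → conv k (λ p q → F p i q))   ∎
  where open ≡-Reasoning

δ : ℕ → ℚ
δ zero    = 1ℚ
δ (suc _) = 0ℚ

conv-δˡ : ∀ n (f : ℕ → ℚ) → conv n (λ i j → δ i * f j) ≡ f n
conv-δˡ zero    f = *-identityˡ (f 0)
conv-δˡ (suc n) f = trans
  (cong₂ _+_ (trans (conv-cong′ n _ _ (λ i j → *-zeroˡ (f j))) (conv-0 n)) (conv-δˡ n (λ j → f (suc j))))
  (+-identityˡ (f (suc n)))

conv-δʳ : ∀ n (f : ℕ → ℚ) → conv n (λ i j → f i * δ j) ≡ f n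
conv-δʳ n f = trans (conv-cong′ n _ _ (λ i j → *-comm (f i) (δ j)))
  (trans (conv-comm n (λ i j → δ i * f j)) (conv-δˡ n f))

ε : ℕ → ℚ
ε zero    = 1ℚ
ε (suc _) = - 1ℚ

-- The Taylor coefficients of sin, cos and sinh at 0.
sinᶜ cosᶜ oddᶜ : ℕ → ℚ
sinᶜ zero          = 0ℚ
sinᶜ (suc zero)    = 1ℚ
sinᶜ (suc (suc n)) = - sinᶜ n
cosᶜ zero          = 1ℚ
cosᶜ (suc zero)    = 0ℚ
cosᶜ (suc (suc n)) = - cosᶜ n
oddᶜ zero          = 0ℚ
oddᶜ (suc zero)    = 1ℚ
oddᶜ (suc (suc n)) = oddᶜ n

antiperiodic-shift : (w : ℕ → ℚ) → (∀ n → w (suc (suc n)) ≡ - w n) →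
  ∀ i j → w (suc (i ℕ.+ j)) * oddᶜ i ≡ - (sinᶜ i * w j)
antiperiodic-shift w w-anti zero j =
  solve 2 (λ x y → x :* con 0ℚ := :- (con 0ℚ :* y)) refl (w (suc j)) (w j)
antiperiodic-shift w w-anti (suc zero) j =
  trans (cong (_* 1ℚ) (w-anti j)) (solve 1 (λ x → (:- x) :* con 1ℚ := :- (con 1ℚ :* x)) refl (w j))
antiperiodic-shift w w-anti (suc (suc i)) j = begin
    w (suc (suc (suc (i ℕ.+ j)))) * oddᶜ i   ≡⟨ cong (_* oddᶜ i) (w-anti (suc (i ℕ.+ j))) ⟩
    (- w (suc (i ℕ.+ j))) * oddᶜ i           ≡⟨ solve 2 (λ x o → (:- x) :* o := :- (x :* o)) refl (w (suc (i ℕ.+ j))) (oddᶜ i) ⟩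
    - (w (suc (i ℕ.+ j)) * oddᶜ i)           ≡⟨ cong -_ (antiperiodic-shift w w-anti i j) ⟩
    - (- (sinᶜ i * w j))                     ≡⟨ solve 2 (λ x y → :- (:- (x :* y)) := :- ((:- x) :* y)) refl (sinᶜ i) (w j) ⟩
    - ((- sinᶜ i) * w j)                     ∎
  where open ≡-Reasoning

m+n≡o⇒m≤o : ∀ {m n o} → m ℕ.+ n ≡ o → m ≤ o
m+n≡o⇒m≤o {m} {n} refl = ℕ.m≤m+n m n

m+n≡o⇒n≤o : ∀ {m n o} → m ℕ.+ n ≡ o → n ≤ o
m+n≡o⇒n≤o {m} {n} refl = ℕ.m≤n+m n m

module TangentNumbers (c e : ℕ → ℚ) (c₀ : c 0 ≡ 1ℚ)
  (c-rec : ∀ n → c (suc n) ≡ conv n (λ i j → (ε i * c i) * c j))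
  (e-rec : ∀ n → e (suc n) ≡ conv n (λ i j → δ i * δ j + (oddᶜ i * e i) * e j)) where

  c⁺ : ℕ → ℚ
  c⁺ zero    = 0ℚ
  c⁺ (suc i) = c (suc i)

  c≡δ+c⁺ : ∀ i → c i ≡ δ i + c⁺ i
  c≡δ+c⁺ zero    = c₀
  c≡δ+c⁺ (suc i) = sym (+-identityˡ _)

  ε*c≡δ-c⁺ : ∀ i → ε i * c i ≡ δ i + - c⁺ i
  ε*c≡δ-c⁺ zero    = cong (1ℚ *_) c₀
  ε*c≡δ-c⁺ (suc i) = solve 1 (λ x → con (- 1ℚ) :* x := con 0ℚ :+ :- x) refl (c (suc i))

  c⁺-rec : ∀ n → c⁺ (suc n) ≡ δ n + - conv n (λ i j → c⁺ i * c⁺ j)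
  c⁺-rec n = begin
      c (suc n)
    ≡⟨ c-rec n ⟩
      conv n (λ i j → (ε i * c i) * c j)
    ≡⟨ conv-cong′ n _ _ (λ i j → cong₂ _*_ (ε*c≡δ-c⁺ i) (c≡δ+c⁺ j)) ⟩
      conv n (λ i j → (δ i + - c⁺ i) * (δ j + c⁺ j))
    ≡⟨ conv-cong′ n _ _ (λ i j → solve 4 (λ di hi dj hj → (di :+ :- hi) :* (dj :+ hj) :=
          (di :* dj :+ di :* hj) :+ (:- (hi :* dj) :+ :- (hi :* hj))) refl (δ i) (c⁺ i) (δ j) (c⁺ j)) ⟩
      conv n (λ i j → (δ i * δ j + δ i * c⁺ j) + (- (c⁺ i * δ j) + - (c⁺ i * c⁺ j)))
    ≡⟨ trans (conv-+ n _ _) (cong₂ _+_ (conv-+ n _ _) (conv-+ n _ _)) ⟩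
      (conv n (λ i j → δ i * δ j) + conv n (λ i j → δ i * c⁺ j))
        + (conv n (λ i j → - (c⁺ i * δ j)) + conv n (λ i j → - (c⁺ i * c⁺ j)))
    ≡⟨ cong₂ _+_ (cong₂ _+_ (conv-δˡ n δ) (conv-δˡ n c⁺))
                 (cong₂ _+_ (trans (conv-neg n _) (cong -_ (conv-δʳ n c⁺))) (conv-neg n _)) ⟩
      (δ n + c⁺ n) + (- c⁺ n + - conv n (λ i j → c⁺ i * c⁺ j))
    ≡⟨ solve 3 (λ d x y → (d :+ x) :+ (:- x :+ :- y) := d :+ :- y) refl (δ n) (c⁺ n) _ ⟩
      δ n + - conv n (λ i j → c⁺ i * c⁺ j)
    ∎
    where open ≡-Reasoning

  -- c⁺ and sinᶜ·e satisfy the same recurrence because sinᶜ(1+i+j)·oddᶜ i = −sinᶜ i·sinᶜ j.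
  c⁺≡sinᶜ*e : ∀ m → c⁺ m ≡ sinᶜ m * e m
  c⁺≡sinᶜ*e = strong-induction-≡ (sym (*-zeroˡ (e 0))) step
    where
    step : ∀ n → (∀ m → m ≤ n → c⁺ m ≡ sinᶜ m * e m) → c⁺ (suc n) ≡ sinᶜ (suc n) * e (suc n)
    step n ih = begin
        c⁺ (suc n)
      ≡⟨ c⁺-rec n ⟩
        δ n + - conv n (λ i j → c⁺ i * c⁺ j)
      ≡⟨ cong (λ x → δ n + - x) (conv-cong n _ _ (λ i j i+j≡n → cong₂ _*_ (ih i (m+n≡o⇒m≤o i+j≡n)) (ih j (m+n≡o⇒n≤o i+j≡n)))) ⟩
        δ n + - conv n X
      ≡⟨ cong₂ _+_ (trans (sym (sinᶜ-suc*δ n)) (cong (sinᶜ (suc n) *_) (sym (conv-δˡ n δ)))) (sym (conv-neg n X)) ⟩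
        sinᶜ (suc n) * conv n (λ i j → δ i * δ j) + conv n (λ i j → - X i j)
      ≡⟨ cong (_+ conv n (λ i j → - X i j)) (sym (conv-* n (sinᶜ (suc n)) (λ i j → δ i * δ j))) ⟩
        conv n (λ i j → sinᶜ (suc n) * (δ i * δ j)) + conv n (λ i j → - X i j)
      ≡⟨ sym (conv-+ n (λ i j → sinᶜ (suc n) * (δ i * δ j)) (λ i j → - X i j)) ⟩
        conv n (λ i j → sinᶜ (suc n) * (δ i * δ j) + - X i j)
      ≡⟨ conv-cong n _ _ pointwise ⟩
        conv n (λ i j → sinᶜ (suc n) * (δ i * δ j + (oddᶜ i * e i) * e j))
      ≡⟨ conv-* n (sinᶜ (suc n)) (λ i j → δ i * δ j + (oddᶜ i * e i) * e j) ⟩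
        sinᶜ (suc n) * conv n (λ i j → δ i * δ j + (oddᶜ i * e i) * e j)
      ≡⟨ cong (sinᶜ (suc n) *_) (sym (e-rec n)) ⟩
        sinᶜ (suc n) * e (suc n)
      ∎
      where
      open ≡-Reasoning
      X : ℕ → ℕ → ℚ
      X i j = (sinᶜ i * e i) * (sinᶜ j * e j)
      sinᶜ-suc*δ : ∀ m → sinᶜ (suc m) * δ m ≡ δ m
      sinᶜ-suc*δ zero    = refl
      sinᶜ-suc*δ (suc m) = *-zeroʳ (- sinᶜ m)
      pointwise : ∀ i j → i ℕ.+ j ≡ n →
        sinᶜ (suc n) * (δ i * δ j) + - X i j ≡ sinᶜ (suc n) * (δ i * δ j + (oddᶜ i * e i) * e j)
      pointwise i j refl = begin
          S * (δ i * δ j) + - X i j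
        ≡⟨ solve 6 (λ S d si ei sj ej → S :* d :+ :- ((si :* ei) :* (sj :* ej)) := S :* d :+ (:- (si :* sj)) :* (ei :* ej))
             refl S (δ i * δ j) (sinᶜ i) (e i) (sinᶜ j) (e j) ⟩
          S * (δ i * δ j) + (- (sinᶜ i * sinᶜ j)) * (e i * e j)
        ≡⟨ cong (λ z → S * (δ i * δ j) + z * (e i * e j)) (sym (antiperiodic-shift sinᶜ (λ _ → refl) i j)) ⟩
          S * (δ i * δ j) + (S * oddᶜ i) * (e i * e j)
        ≡⟨ solve 5 (λ S d o ei ej → S :* d :+ (S :* o) :* (ei :* ej) := S :* (d :+ (o :* ei) :* ej))
             refl S (δ i * δ j) (oddᶜ i) (e i) (e j) ⟩
          S * (δ i * δ j + (oddᶜ i * e i) * e j)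
        ∎
        where S = sinᶜ (suc (i ℕ.+ j))

module CosineIdentity (t β : ℚ) (β≡t+t : β ≡ t + t) (c e a b D : ℕ → ℚ)
  (c₀ : c 0 ≡ 1ℚ) (a₀ : a 0 ≡ 1ℚ) (b₀ : b 0 ≡ 1ℚ) (D₀ : D 0 ≡ 1ℚ)
  (c-rec : ∀ n → c (suc n) ≡ conv n (λ i j → (ε i * c i) * c j))
  (e-rec : ∀ n → e (suc n) ≡ conv n (λ i j → δ i * δ j + (oddᶜ i * e i) * e j))
  (a-rec : ∀ n → a (suc n) ≡ conv n (λ i j → (t * (ε i * a i)) * c j))
  (b-rec : ∀ n → b (suc n) ≡ conv n (λ i j → (ε i * c i) * (t * b j)))
  (D-rec : ∀ n → D (suc n) ≡ conv n (λ i j → δ i * (δ j * β) + (oddᶜ i * e i) * (β * D j))) where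

  open TangentNumbers c e c₀ c-rec e-rec

  ā : ℕ → ℚ
  ā i = ε i * a i

  s : ℕ → ℚ
  s n = conv n (λ i j → ā i * b j)

  -- Expanding a and b once more, the two t-terms combine into β·c⁺ because c and ε·c differ only in the sign of c⁺.
  s-rec : ∀ n → s (suc n) ≡ (- β) * conv n (λ i j → c⁺ i * s j)
  s-rec n = begin
      conv n (λ i j → ā (suc i) * b j) + conv n (λ i j → ā i * b (suc j))
    ≡⟨ cong₂ _+_ expand-a expand-b ⟩
      conv n (λ i k → conv k (λ p q → F₁ i p q)) + conv n (λ i k → conv k (λ p q → F₂ i p q))
    ≡⟨ sym (conv-+ n (λ i k → conv k (λ p q → F₁ i p q)) (λ i k → conv k (λ p q → F₂ i p q))) ⟩
      conv n (λ i k → conv k (λ p q → F₁ i p q) + conv k (λ p q → F₂ i p q))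
    ≡⟨ conv-cong′ n _ _ (λ i k → sym (conv-+ k (λ p q → F₁ i p q) (λ p q → F₂ i p q))) ⟩
      conv n (λ i k → conv k (λ p q → F₁ i p q + F₂ i p q))
    ≡⟨ conv-cong′ n _ _ (λ i k → conv-cong′ k _ _ (λ p q → combine i p q)) ⟩
      conv n (λ i k → conv k (λ p q → (- β) * (c⁺ p * (ā i * b q))))
    ≡⟨ conv-exchange n (λ i p q → (- β) * (c⁺ p * (ā i * b q))) ⟩
      conv n (λ i k → conv k (λ p q → (- β) * (c⁺ i * (ā p * b q))))
    ≡⟨ conv-cong′ n _ _ (λ i k → trans (conv-* k (- β) (λ p q → c⁺ i * (ā p * b q)))
                                        (cong ((- β) *_) (conv-* k (c⁺ i) (λ p q → ā p * b q)))) ⟩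
      conv n (λ i k → (- β) * (c⁺ i * s k))
    ≡⟨ conv-* n (- β) (λ i k → c⁺ i * s k) ⟩
      (- β) * conv n (λ i j → c⁺ i * s j)
    ∎
    where
    open ≡-Reasoning
    F₁ F₂ : ℕ → ℕ → ℕ → ℚ
    F₁ p q j = (- t) * (ā p * (c q * b j))
    F₂ i p q = t * (ā i * ((ε p * c p) * b q))
    expand-a : conv n (λ i j → ā (suc i) * b j) ≡ conv n (λ i k → conv k (λ p q → F₁ i p q))
    expand-a = trans (conv-cong′ n _ _ λ i j → begin
        (- 1ℚ * a (suc i)) * b j
      ≡⟨ cong (λ z → (- 1ℚ * z) * b j) (a-rec i) ⟩
        (- 1ℚ * conv i (λ p q → (t * ā p) * c q)) * b j
      ≡⟨ solve 2 (λ x y → (con (- 1ℚ) :* x) :* y := (:- y) :* x) refl (conv i (λ p q → (t * ā p) * c q)) (b j) ⟩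
        (- b j) * conv i (λ p q → (t * ā p) * c q)
      ≡⟨ sym (conv-* i (- b j) (λ p q → (t * ā p) * c q)) ⟩
        conv i (λ p q → (- b j) * ((t * ā p) * c q))
      ≡⟨ conv-cong′ i _ _ (λ p q → solve 4 (λ t A C B → (:- B) :* ((t :* A) :* C) := (:- t) :* (A :* (C :* B)))
                                            refl t (ā p) (c q) (b j)) ⟩
        conv i (λ p q → F₁ p q j)
      ∎)
      (conv-assoc n F₁)
    expand-b : conv n (λ i j → ā i * b (suc j)) ≡ conv n (λ i k → conv k (λ p q → F₂ i p q))
    expand-b = conv-cong′ n _ _ λ i j → begin
        ā i * b (suc j)
      ≡⟨ cong (ā i *_) (b-rec j) ⟩
        ā i * conv j (λ p q → (ε p * c p) * (t * b q))
      ≡⟨ sym (conv-* j (ā i) (λ p q → (ε p * c p) * (t * b q))) ⟩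
        conv j (λ p q → ā i * ((ε p * c p) * (t * b q)))
      ≡⟨ conv-cong′ j _ _ (λ p q → solve 4 (λ A E t B → A :* (E :* (t :* B)) := t :* (A :* (E :* B)))
                                            refl (ā i) (ε p * c p) t (b q)) ⟩
        conv j (λ p q → F₂ i p q)
      ∎
    combine : ∀ i p q → F₁ i p q + F₂ i p q ≡ (- β) * (c⁺ p * (ā i * b q))
    combine i p q = begin
        (- t) * (ā i * (c p * b q)) + t * (ā i * ((ε p * c p) * b q))
      ≡⟨ cong₂ (λ x y → (- t) * (ā i * (x * b q)) + t * (ā i * (y * b q))) (c≡δ+c⁺ p) (ε*c≡δ-c⁺ p) ⟩
        (- t) * (ā i * ((δ p + c⁺ p) * b q)) + t * (ā i * ((δ p + - c⁺ p) * b q))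
      ≡⟨ solve 5 (λ t A d h B → (:- t) :* (A :* ((d :+ h) :* B)) :+ t :* (A :* ((d :+ :- h) :* B))
                                := (:- (t :+ t)) :* (h :* (A :* B))) refl t (ā i) (δ p) (c⁺ p) (b q) ⟩
        (- (t + t)) * (c⁺ p * (ā i * b q))
      ≡⟨ cong (λ z → (- z) * (c⁺ p * (ā i * b q))) (sym β≡t+t) ⟩
        (- β) * (c⁺ p * (ā i * b q))
      ∎

  cosᶜ*D-rec : ∀ n → cosᶜ (suc n) * D (suc n) ≡ (- β) * conv n (λ i j → (sinᶜ i * e i) * (cosᶜ j * D j))
  cosᶜ*D-rec n = begin
      cosᶜ (suc n) * D (suc n)
    ≡⟨ cong (cosᶜ (suc n) *_) (D-rec n) ⟩
      cosᶜ (suc n) * conv n G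
    ≡⟨ sym (conv-* n (cosᶜ (suc n)) G) ⟩
      conv n (λ i j → cosᶜ (suc n) * G i j)
    ≡⟨ conv-cong n _ _ pointwise ⟩
      conv n (λ i j → (- β) * ((sinᶜ i * e i) * (cosᶜ j * D j)))
    ≡⟨ conv-* n (- β) (λ i j → (sinᶜ i * e i) * (cosᶜ j * D j)) ⟩
      (- β) * conv n (λ i j → (sinᶜ i * e i) * (cosᶜ j * D j))
    ∎
    where
    open ≡-Reasoning
    G : ℕ → ℕ → ℚ
    G i j = δ i * (δ j * β) + (oddᶜ i * e i) * (β * D j)
    δ*δ : ∀ i j → δ i * δ j ≡ δ (i ℕ.+ j)
    δ*δ zero    j = *-identityˡ (δ j)
    δ*δ (suc i) j = *-zeroˡ (δ j)
    cosᶜ-suc*δ : ∀ m → cosᶜ (suc m) * δ m ≡ 0ℚ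
    cosᶜ-suc*δ zero    = refl
    cosᶜ-suc*δ (suc m) = *-zeroʳ (- cosᶜ m)
    pointwise : ∀ i j → i ℕ.+ j ≡ n → cosᶜ (suc n) * G i j ≡ (- β) * ((sinᶜ i * e i) * (cosᶜ j * D j))
    pointwise i j refl = begin
        C * (δ i * (δ j * β) + (oddᶜ i * e i) * (β * D j))
      ≡⟨ solve 7 (λ C di dj b o ei d → C :* (di :* (dj :* b) :+ (o :* ei) :* (b :* d))
                                       := b :* (C :* (di :* dj)) :+ (C :* o) :* (b :* (ei :* d)))
           refl C (δ i) (δ j) β (oddᶜ i) (e i) (D j) ⟩
        β * (C * (δ i * δ j)) + (C * oddᶜ i) * (β * (e i * D j))
      ≡⟨ cong₂ (λ x y → β * x + y * (β * (e i * D j)))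
           (trans (cong (C *_) (δ*δ i j)) (cosᶜ-suc*δ (i ℕ.+ j))) (antiperiodic-shift cosᶜ (λ _ → refl) i j) ⟩
        β * 0ℚ + (- (sinᶜ i * cosᶜ j)) * (β * (e i * D j))
      ≡⟨ solve 5 (λ b si cj ei d → b :* con 0ℚ :+ (:- (si :* cj)) :* (b :* (ei :* d)) := (:- b) :* ((si :* ei) :* (cj :* d)))
           refl β (sinᶜ i) (cosᶜ j) (e i) (D j) ⟩
        (- β) * ((sinᶜ i * e i) * (cosᶜ j * D j))
      ∎
      where C = cosᶜ (suc (i ℕ.+ j))

  s≡cosᶜ*D : ∀ n → s n ≡ cosᶜ n * D n
  s≡cosᶜ*D = strong-induction-≡ (trans (cong₂ (λ x y → (1ℚ * x) * y) a₀ b₀) (cong (1ℚ *_) (sym D₀))) step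
    where
    open ≡-Reasoning
    step : ∀ n → (∀ m → m ≤ n → s m ≡ cosᶜ m * D m) → s (suc n) ≡ cosᶜ (suc n) * D (suc n)
    step n ih = begin
        s (suc n)
      ≡⟨ s-rec n ⟩
        (- β) * conv n (λ i j → c⁺ i * s j)
      ≡⟨ cong ((- β) *_) (conv-cong n _ _ (λ i j i+j≡n → cong₂ _*_ (c⁺≡sinᶜ*e i) (ih j (m+n≡o⇒n≤o i+j≡n)))) ⟩
        (- β) * conv n (λ i j → (sinᶜ i * e i) * (cosᶜ j * D j))
      ≡⟨ sym (cosᶜ*D-rec n) ⟩
        cosᶜ (suc n) * D (suc n)
      ∎

-- Sums over lists

∑-++ : {A : Set} (xs ys : List A) (f : A → ℚ) → ∑ (xs ++ ys) f ≡ ∑ xs f + ∑ ys f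
∑-++ []       ys f = sym (+-identityˡ _)
∑-++ (x ∷ xs) ys f = trans (cong (f x +_) (∑-++ xs ys f)) (sym (+-assoc (f x) _ _))

∑-map : {A B : Set} (g : A → B) (xs : List A) (f : B → ℚ) → ∑ (map g xs) f ≡ ∑ xs (f ∘ g)
∑-map g []       f = refl
∑-map g (x ∷ xs) f = cong (f (g x) +_) (∑-map g xs f)

∑-concatMap : {A B : Set} (F : A → List B) (xs : List A) (f : B → ℚ) →
  ∑ (concatMap F xs) f ≡ ∑ xs (λ x → ∑ (F x) f)
∑-concatMap F []       f = refl
∑-concatMap F (x ∷ xs) f = trans (∑-++ (F x) (concatMap F xs) f) (cong (∑ (F x) f +_) (∑-concatMap F xs f))

∑-cong : {A : Set} (xs : List A) (f g : A → ℚ) → (∀ {x} → x ∈ xs → f x ≡ g x) → ∑ xs f ≡ ∑ xs g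
∑-cong []       f g f≡g = refl
∑-cong (x ∷ xs) f g f≡g = cong₂ _+_ (f≡g (here refl)) (∑-cong xs f g (f≡g ∘ there))

∑-+ : {A : Set} (xs : List A) (f g : A → ℚ) → ∑ xs (λ x → f x + g x) ≡ ∑ xs f + ∑ xs g
∑-+ []       f g = refl
∑-+ (x ∷ xs) f g = trans (cong (f x + g x +_) (∑-+ xs f g)) (+-interchange (f x) (g x) _ _)

∑-*ʳ : {A : Set} (xs : List A) (f : A → ℚ) (k : ℚ) → ∑ xs (λ x → f x * k) ≡ ∑ xs f * k
∑-*ʳ []       f k = sym (*-zeroˡ k)
∑-*ʳ (x ∷ xs) f k = trans (cong (f x * k +_) (∑-*ʳ xs f k)) (sym (*-distribʳ-+ k (f x) _))

∑-*ˡ : {A : Set} (xs : List A) (f : A → ℚ) (k : ℚ) → ∑ xs (λ x → k * f x) ≡ k * ∑ xs f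
∑-*ˡ []       f k = sym (*-zeroʳ k)
∑-*ˡ (x ∷ xs) f k = trans (cong (k * f x +_) (∑-*ˡ xs f k)) (sym (*-distribˡ-+ k (f x) _))

∑-product : {A B : Set} (xs : List A) (ys : List B) (u : A → ℚ) (v : B → ℚ) →
  ∑ xs (λ x → ∑ ys (λ y → u x * v y)) ≡ ∑ xs u * ∑ ys v
∑-product xs ys u v = trans (∑-cong xs _ _ (λ {x} _ → ∑-*ˡ ys v (u x))) (∑-*ʳ xs u (∑ ys v))

∑-↭ : {A : Set} {xs ys : List A} (f : A → ℚ) → xs ↭ ys → ∑ xs f ≡ ∑ ys f
∑-↭ f ↭.refl                  = refl
∑-↭ f (↭.prep x xs↭ys)        = cong (f x +_) (∑-↭ f xs↭ys)
∑-↭ f (↭.swap {xs = xs} x y xs↭ys) = trans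
  (solve 3 (λ a b c → a :+ (b :+ c) := b :+ (a :+ c)) refl (f x) (f y) (∑ xs f))
  (cong (λ z → f y + (f x + z)) (∑-↭ f xs↭ys))
∑-↭ f (↭.trans xs↭ys ys↭zs)   = trans (∑-↭ f xs↭ys) (∑-↭ f ys↭zs)

∑-filter : {A : Set} (p : A → Bool) (xs : List A) (f : A → ℚ) →
  ∑ (filter (λ x → p x Bool.≟ true) xs) f ≡ ∑ xs (λ x → if p x then f x else 0ℚ)
∑-filter p []       f = refl
∑-filter p (x ∷ xs) f with p x
... | true  = cong (f x +_) (∑-filter p xs f)
... | false = trans (∑-filter p xs f) (sym (+-identityˡ _))

-- The statistics under relabelling and at a least letter

<ᵇ-true : ∀ {a b} → a < b → (a <ᵇ b) ≡ true
<ᵇ-true a<b = Equivalence.to T-≡ (ℕ.<⇒<ᵇ a<b)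

<ᵇ-false : ∀ {a b} → b ≤ a → (a <ᵇ b) ≡ false
<ᵇ-false {a} {b} b≤a with a <ᵇ b in eq
... | false = refl
... | true  = ⊥-elim (ℕ.<⇒≱ (ℕ.<ᵇ⇒< a b (subst T (sym eq) _)) b≤a)

module _ {h : ℕ → ℕ} (h-mono : h Preserves _<_ ⟶ _<_) where

  <ᵇ-map : ∀ a b → (h a <ᵇ h b) ≡ (a <ᵇ b)
  <ᵇ-map a b with ℕ.<-cmp a b
  ... | tri< a<b _ _    = trans (<ᵇ-true (h-mono a<b)) (sym (<ᵇ-true a<b))
  ... | tri≈ _ refl _   = trans (<ᵇ-false {h a} ℕ.≤-refl) (sym (<ᵇ-false {a} ℕ.≤-refl))
  ... | tri> _ _ b<a    = trans (<ᵇ-false (ℕ.<⇒≤ (h-mono b<a))) (sym (<ᵇ-false (ℕ.<⇒≤ b<a)))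

  des-map : ∀ σ → des (map h σ) ≡ des σ
  des-map []          = refl
  des-map (x ∷ [])    = refl
  des-map (x ∷ y ∷ σ) = cong₂ (λ b n → (if b then 1 else 0) ℕ.+ n) (<ᵇ-map y x) (des-map (y ∷ σ))

  lrminFrom-map : ∀ m σ → lrminFrom (h m) (map h σ) ≡ lrminFrom m σ
  lrminFrom-map m []      = refl
  lrminFrom-map m (x ∷ σ) rewrite <ᵇ-map x m with x <ᵇ m
  ... | true  = cong suc (lrminFrom-map x σ)
  ... | false = lrminFrom-map m σ

  LRmin-map : ∀ σ → LRmin (map h σ) ≡ LRmin σ
  LRmin-map []      = refl
  LRmin-map (x ∷ σ) = cong suc (lrminFrom-map x σ)

  RLmin-map : ∀ σ → RLmin (map h σ) ≡ RLmin σ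
  RLmin-map σ = trans (cong LRmin (sym (List.reverse-map h σ))) (LRmin-map (reverse σ))

  mutual
    isDownUp-map : ∀ σ → isDownUp (map h σ) ≡ isDownUp σ
    isDownUp-map []          = refl
    isDownUp-map (x ∷ [])    = refl
    isDownUp-map (x ∷ y ∷ σ) = cong₂ _∧_ (<ᵇ-map y x) (isUpDown-map (y ∷ σ))

    isUpDown-map : ∀ σ → isUpDown (map h σ) ≡ isUpDown σ
    isUpDown-map []          = refl
    isUpDown-map (x ∷ [])    = refl
    isUpDown-map (x ∷ y ∷ σ) = cong₂ _∧_ (<ᵇ-map x y) (isDownUp-map (y ∷ σ))

mutual
  oddLength evenLength : List ℕ → Bool
  oddLength  []      = false
  oddLength  (_ ∷ A) = evenLength A
  evenLength []      = true
  evenLength (_ ∷ A) = oddLength A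

∧-left-commute : ∀ a b c d → a ∧ (b ∧ (c ∧ d)) ≡ b ∧ ((a ∧ c) ∧ d)
∧-left-commute true  b     c d = refl
∧-left-commute false true  c d = refl
∧-left-commute false false c d = refl

Above : ℕ → List ℕ → Set
Above x A = ∀ {z} → z ∈ A → x < z

module _ {x : ℕ} where

  private
    Above-∷ : ∀ {a A} → Above x (a ∷ A) → Above x A
    Above-∷ x<aA z∈A = x<aA (there z∈A)

    Above-reverse : ∀ {A} → Above x A → Above x (reverse A)
    Above-reverse x<A z∈rA = x<A (Any.reverse⁻ z∈rA)

  des-x∷ : ∀ B → Above x B → des (x ∷ B) ≡ des B
  des-x∷ []      _   = refl
  des-x∷ (b ∷ B) x<B rewrite <ᵇ-false {b} {x} (ℕ.<⇒≤ (x<B (here refl))) = refl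

  des-split : ∀ A B → Above x A → Above x B → des (A ++ x ∷ B) ≡ des A ℕ.+ (if null A then 0 else 1) ℕ.+ des B
  des-split []           B x<A x<B = des-x∷ B x<B
  des-split (a ∷ [])     B x<A x<B rewrite <ᵇ-true (x<A (here refl)) = cong suc (des-x∷ B x<B)
  des-split (a ∷ a′ ∷ A) B x<A x<B = trans
    (cong ((if a′ <ᵇ a then 1 else 0) ℕ.+_) (des-split (a′ ∷ A) B (Above-∷ x<A) x<B))
    (regroup (if a′ <ᵇ a then 1 else 0) (des (a′ ∷ A)) (des B))
    where
    regroup : ∀ d m n → d ℕ.+ (m ℕ.+ 1 ℕ.+ n) ≡ d ℕ.+ m ℕ.+ 1 ℕ.+ n
    regroup d m n = trans (sym (ℕ.+-assoc d (m ℕ.+ 1) n)) (cong (ℕ._+ n) (sym (ℕ.+-assoc d m 1)))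

  lrminFrom-above : ∀ B → Above x B → lrminFrom x B ≡ 0
  lrminFrom-above []      _   = refl
  lrminFrom-above (b ∷ B) x<B rewrite <ᵇ-false {b} {x} (ℕ.<⇒≤ (x<B (here refl))) = lrminFrom-above B (Above-∷ x<B)

  lrminFrom-split : ∀ m A B → x < m → Above x A → Above x B → lrminFrom m (A ++ x ∷ B) ≡ suc (lrminFrom m A)
  lrminFrom-split m []      B x<m _   x<B rewrite <ᵇ-true x<m = cong suc (lrminFrom-above B x<B)
  lrminFrom-split m (a ∷ A) B x<m x<A x<B with a <ᵇ m
  ... | true  = cong suc (lrminFrom-split a A B (x<A (here refl)) (Above-∷ x<A) x<B)
  ... | false = lrminFrom-split m A B x<m (Above-∷ x<A) x<B

  LRmin-split : ∀ A B → Above x A → Above x B → LRmin (A ++ x ∷ B) ≡ suc (LRmin A)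
  LRmin-split []      B _   x<B = cong suc (lrminFrom-above B x<B)
  LRmin-split (a ∷ A) B x<A x<B = cong suc (lrminFrom-split a A B (x<A (here refl)) (Above-∷ x<A) x<B)

  RLmin-split : ∀ A B → Above x A → Above x B → RLmin (A ++ x ∷ B) ≡ suc (RLmin B)
  RLmin-split A B x<A x<B = trans (cong LRmin reverse-split)
    (LRmin-split (reverse B) (reverse A) (Above-reverse x<B) (Above-reverse x<A))
    where
    reverse-split : reverse (A ++ x ∷ B) ≡ reverse B ++ x ∷ reverse A
    reverse-split = trans (List.reverse-++ A (x ∷ B))
      (trans (cong (_++ reverse A) (List.unfold-reverse x B)) (List.++-assoc (reverse B) [ x ] (reverse A)))

  isDownUp-x∷ : ∀ B → Above x B → isDownUp (x ∷ B) ≡ null B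
  isDownUp-x∷ []      _   = refl
  isDownUp-x∷ (b ∷ B) x<B rewrite <ᵇ-false {b} {x} (ℕ.<⇒≤ (x<B (here refl))) = refl

  isUpDown-x∷ : ∀ B → Above x B → isUpDown (x ∷ B) ≡ isDownUp B
  isUpDown-x∷ []      _   = refl
  isUpDown-x∷ (b ∷ B) x<B rewrite <ᵇ-true (x<B (here refl)) = refl

  -- The step into the least letter x is a descent, which a down-up word allows only at an
  -- even position, i.e. when the prefix has odd length.
  mutual
    isDownUp-split : ∀ a A B → Above x (a ∷ A) → Above x B →
      isDownUp ((a ∷ A) ++ x ∷ B) ≡ oddLength (a ∷ A) ∧ (isDownUp (a ∷ A) ∧ isDownUp B)
    isDownUp-split a []       B x<A x<B rewrite <ᵇ-true (x<A (here refl)) = isUpDown-x∷ B x<B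
    isDownUp-split a (a′ ∷ A) B x<A x<B = trans
      (cong ((a′ <ᵇ a) ∧_) (isUpDown-split a′ A B (Above-∷ x<A) x<B))
      (∧-left-commute (a′ <ᵇ a) (evenLength (a′ ∷ A)) _ _)

    isUpDown-split : ∀ a A B → Above x (a ∷ A) → Above x B →
      isUpDown ((a ∷ A) ++ x ∷ B) ≡ evenLength (a ∷ A) ∧ (isUpDown (a ∷ A) ∧ isDownUp B)
    isUpDown-split a []       B x<A x<B rewrite <ᵇ-false {a} {x} (ℕ.<⇒≤ (x<A (here refl))) = refl
    isUpDown-split a (a′ ∷ A) B x<A x<B = trans
      (cong ((a <ᵇ a′) ∧_) (isDownUp-split a′ A B (Above-∷ x<A) x<B))
      (∧-left-commute (a <ᵇ a′) (oddLength (a′ ∷ A)) _ _)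

-- Arrangements

range : ℕ → ℕ → List ℕ
range s zero    = []
range s (suc k) = s ∷ range (suc s) k

length-range : ∀ s k → length (range s k) ≡ k
length-range s zero    = refl
length-range s (suc k) = cong suc (length-range (suc s) k)

Split : Set
Split = List ℕ × List ℕ

splits : List ℕ → List Split
splits []      = ([] , []) ∷ []
splits (x ∷ X) = map (map₁ (x ∷_)) (splits X) ++ map (map₂ (x ∷_)) (splits X)

glue : ℕ → List ℕ → List ℕ → List ℕ
glue x A B = A ++ x ∷ B

-- The fuel f ≥ length X only serves to make the recursion structural.
mutual
  arrangementsOf : ℕ → List ℕ → List (List ℕ)
  arrangementsOf zero    _       = [] ∷ []
  arrangementsOf (suc f) []      = [] ∷ []
  arrangementsOf (suc f) (x ∷ X) = concatMap (arrangementsAround f x) (splits X)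

  arrangementsAround : ℕ → ℕ → Split → List (List ℕ)
  arrangementsAround f x p = concatMap (λ A → map (glue x A) (arrangementsOf f (proj₂ p))) (arrangementsOf f (proj₁ p))

arrangements : ℕ → List (List ℕ)
arrangements n = arrangementsOf n (range 1 n)

∑-splits : ∀ X (F : ℕ → ℕ → ℚ) → ∑ (splits X) (λ p → F (length (proj₁ p)) (length (proj₂ p))) ≡ conv (length X) F
∑-splits []      F = +-identityʳ _
∑-splits (x ∷ X) F = trans (∑-++ (map (map₁ (x ∷_)) (splits X)) _ _)
  (cong₂ _+_ (trans (∑-map (map₁ (x ∷_)) (splits X) _) (∑-splits X (λ i j → F (suc i) j)))
             (trans (∑-map (map₂ (x ∷_)) (splits X) _) (∑-splits X (λ i j → F i (suc j)))))

∈-splits⁻ : ∀ {x X p} → p ∈ splits (x ∷ X) → ∃[ q ] (q ∈ splits X × (p ≡ map₁ (x ∷_) q ⊎ p ≡ map₂ (x ∷_) q))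
∈-splits⁻ {x} {X} p∈ with ∈-++⁻ (map (map₁ (x ∷_)) (splits X)) p∈
... | inj₁ p∈ˡ = let (q , q∈ , p≡) = ∈-map⁻ (map₁ (x ∷_)) p∈ˡ in q , q∈ , inj₁ p≡
... | inj₂ p∈ʳ = let (q , q∈ , p≡) = ∈-map⁻ (map₂ (x ∷_)) p∈ʳ in q , q∈ , inj₂ p≡

length-split : ∀ X {p} → p ∈ splits X → length (proj₁ p) ℕ.+ length (proj₂ p) ≡ length X
length-split []      (here refl) = refl
length-split (x ∷ X) p∈ with ∈-splits⁻ {x} {X} p∈
... | q , q∈ , inj₁ refl = cong suc (length-split X q∈)
... | q , q∈ , inj₂ refl = trans (ℕ.+-suc (length (proj₁ q)) _) (cong suc (length-split X q∈))

length-splitˡ-≤ : ∀ X {p} → p ∈ splits X → length (proj₁ p) ≤ length X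
length-splitˡ-≤ X {p} p∈ = ℕ.≤-trans (ℕ.m≤m+n _ (length (proj₂ p))) (ℕ.≤-reflexive (length-split X p∈))

length-splitʳ-≤ : ∀ X {p} → p ∈ splits X → length (proj₂ p) ≤ length X
length-splitʳ-≤ X {p} p∈ = ℕ.≤-trans (ℕ.m≤n+m _ (length (proj₁ p))) (ℕ.≤-reflexive (length-split X p∈))

splitˡ-⊆ : ∀ X {p z} → p ∈ splits X → z ∈ proj₁ p → z ∈ X
splitˡ-⊆ []      (here refl) ()
splitˡ-⊆ (x ∷ X) p∈ z∈ with ∈-splits⁻ {x} {X} p∈ | z∈
... | q , q∈ , inj₁ refl | here z≡x  = here z≡x
... | q , q∈ , inj₁ refl | there z∈q = there (splitˡ-⊆ X q∈ z∈q)
... | q , q∈ , inj₂ refl | z∈q       = there (splitˡ-⊆ X q∈ z∈q)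

splitʳ-⊆ : ∀ X {p z} → p ∈ splits X → z ∈ proj₂ p → z ∈ X
splitʳ-⊆ []      (here refl) ()
splitʳ-⊆ (x ∷ X) p∈ z∈ with ∈-splits⁻ {x} {X} p∈ | z∈
... | q , q∈ , inj₁ refl | z∈q       = there (splitʳ-⊆ X q∈ z∈q)
... | q , q∈ , inj₂ refl | here z≡x  = here z≡x
... | q , q∈ , inj₂ refl | there z∈q = there (splitʳ-⊆ X q∈ z∈q)

SortedAbove : ℕ → List ℕ → Set
SortedAbove p []      = ⊤
SortedAbove p (y ∷ Y) = p < y × SortedAbove y Y

SortedAbove-weaken : ∀ {q p} Y → q ≤ p → SortedAbove p Y → SortedAbove q Y
SortedAbove-weaken []      _   _              = tt
SortedAbove-weaken (y ∷ Y) q≤p (p<y , sorted) = ℕ.≤-<-trans q≤p p<y , sorted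

SortedAbove⇒Above : ∀ {p} Y → SortedAbove p Y → Above p Y
SortedAbove⇒Above (y ∷ Y) (p<y , _)      (here refl) = p<y
SortedAbove⇒Above (y ∷ Y) (p<y , sorted) (there z∈Y) = ℕ.<-trans p<y (SortedAbove⇒Above Y sorted z∈Y)

range-sorted : ∀ p s k → p < s → SortedAbove p (range s k)
range-sorted p s zero    _   = tt
range-sorted p s (suc k) p<s = p<s , range-sorted s (suc s) k ℕ.≤-refl

splits-sorted : ∀ {m} X {p} → p ∈ splits X → SortedAbove m X → SortedAbove m (proj₁ p) × SortedAbove m (proj₂ p)
splits-sorted []      (here refl) _ = tt , tt
splits-sorted (x ∷ X) p∈ (m<x , sorted) with ∈-splits⁻ {x} {X} p∈
... | r , r∈ , inj₁ refl = (m<x , proj₁ IH) , SortedAbove-weaken (proj₂ r) (ℕ.<⇒≤ m<x) (proj₂ IH)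
  where IH = splits-sorted X r∈ sorted
... | r , r∈ , inj₂ refl = SortedAbove-weaken (proj₁ r) (ℕ.<⇒≤ m<x) (proj₁ IH) , (m<x , proj₂ IH)
  where IH = splits-sorted X r∈ sorted

∈-arrangementsOf⁻ : ∀ f x X {σ} → σ ∈ arrangementsOf (suc f) (x ∷ X) →
  Σ Split λ p → p ∈ splits X × Σ (List ℕ) λ A → A ∈ arrangementsOf f (proj₁ p) ×
    Σ (List ℕ) λ B → B ∈ arrangementsOf f (proj₂ p) × σ ≡ glue x A B
∈-arrangementsOf⁻ f x X σ∈ =
  let (p , p∈ , σ∈p) = find (∈-concatMap⁻ (arrangementsAround f x) {xs = splits X} σ∈)
      (A , A∈ , σ∈A) = find (∈-concatMap⁻ (λ A → map (glue x A) (arrangementsOf f (proj₂ p))) {xs = arrangementsOf f (proj₁ p)} σ∈p)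
      (B , B∈ , σ≡) = ∈-map⁻ (glue x A) σ∈A
  in p , p∈ , A , A∈ , B , B∈ , σ≡

∈-arrangementsOf⁺ : ∀ f x X {p A B} → p ∈ splits X → A ∈ arrangementsOf f (proj₁ p) → B ∈ arrangementsOf f (proj₂ p) →
  glue x A B ∈ arrangementsOf (suc f) (x ∷ X)
∈-arrangementsOf⁺ f x X {p} {A} p∈ A∈ B∈ =
  ∈-concatMap⁺ (arrangementsAround f x) {xs = splits X} (lose p∈
    (∈-concatMap⁺ (λ A → map (glue x A) (arrangementsOf f (proj₂ p))) {xs = arrangementsOf f (proj₁ p)}
      (lose A∈ (∈-map⁺ (glue x A) B∈))))

arrangementsOf-⊆ : ∀ f X {σ z} → σ ∈ arrangementsOf f X → z ∈ σ → z ∈ X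
arrangementsOf-⊆ zero    X       (here refl) ()
arrangementsOf-⊆ (suc f) []      (here refl) ()
arrangementsOf-⊆ (suc f) (x ∷ X) σ∈ z∈ with ∈-arrangementsOf⁻ f x X σ∈
... | p , p∈ , A , A∈ , B , B∈ , refl with ∈-++⁻ A z∈
...   | inj₁ z∈A         = there (splitˡ-⊆ X p∈ (arrangementsOf-⊆ f (proj₁ p) A∈ z∈A))
...   | inj₂ (here z≡x)  = here z≡x
...   | inj₂ (there z∈B) = there (splitʳ-⊆ X p∈ (arrangementsOf-⊆ f (proj₂ p) B∈ z∈B))

length-arrangementsOf : ∀ f X {σ} → length X ≤ f → σ ∈ arrangementsOf f X → length σ ≡ length X
length-arrangementsOf zero    []      _         (here refl) = refl
length-arrangementsOf (suc f) []      _         (here refl) = refl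
length-arrangementsOf (suc f) (x ∷ X) (s≤s X≤f) σ∈ with ∈-arrangementsOf⁻ f x X σ∈
... | p , p∈ , A , A∈ , B , B∈ , refl = begin
    length (A ++ x ∷ B)                       ≡⟨ List.length-++ A ⟩
    length A ℕ.+ suc (length B)               ≡⟨ cong₂ (λ a b → a ℕ.+ suc b)
                                                   (length-arrangementsOf f (proj₁ p) (ℕ.≤-trans (length-splitˡ-≤ X p∈) X≤f) A∈)
                                                   (length-arrangementsOf f (proj₂ p) (ℕ.≤-trans (length-splitʳ-≤ X p∈) X≤f) B∈) ⟩
    length (proj₁ p) ℕ.+ suc (length (proj₂ p)) ≡⟨ ℕ.+-suc (length (proj₁ p)) _ ⟩
    suc (length (proj₁ p) ℕ.+ length (proj₂ p)) ≡⟨ cong suc (length-split X p∈) ⟩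
    suc (length X)                            ∎
  where open ≡-Reasoning

length-arrangements : ∀ n {σ} → σ ∈ arrangements n → length σ ≡ n
length-arrangements n σ∈ = trans (length-arrangementsOf n (range 1 n) (ℕ.≤-reflexive (length-range 1 n)) σ∈) (length-range 1 n)

concatMap-cong-∈ : {A B : Set} (xs : List A) (F G : A → List B) → (∀ {x} → x ∈ xs → F x ≡ G x) →
  concatMap F xs ≡ concatMap G xs
concatMap-cong-∈ []       F G F≡G = refl
concatMap-cong-∈ (x ∷ xs) F G F≡G = cong₂ _++_ (F≡G (here refl)) (concatMap-cong-∈ xs F G (F≡G ∘ there))

arrangementsOf-suc : ∀ f X → length X ≤ f → arrangementsOf (suc f) X ≡ arrangementsOf f X
arrangementsOf-suc zero    []      _         = refl
arrangementsOf-suc (suc f) []      _         = refl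
arrangementsOf-suc (suc f) (x ∷ X) (s≤s X≤f) = concatMap-cong-∈ (splits X) _ _ (λ {p} p∈ →
  cong₂ (λ L M → concatMap (λ A → map (glue x A) M) L)
    (arrangementsOf-suc f (proj₁ p) (ℕ.≤-trans (length-splitˡ-≤ X p∈) X≤f))
    (arrangementsOf-suc f (proj₂ p) (ℕ.≤-trans (length-splitʳ-≤ X p∈) X≤f)))

arrangementsOf-fuel : ∀ f X → length X ≤ f → arrangementsOf f X ≡ arrangementsOf (length X) X
arrangementsOf-fuel zero    []  _   = refl
arrangementsOf-fuel (suc f) X X≤f with ℕ.m≤n⇒m<n∨m≡n X≤f
... | inj₂ X≡f rewrite X≡f   = refl
... | inj₁ (s≤s X≤f′)        = trans (arrangementsOf-suc f X X≤f′) (arrangementsOf-fuel f X X≤f′)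

mapSplit : (ℕ → ℕ) → Split → Split
mapSplit h p = map h (proj₁ p) , map h (proj₂ p)

splits-map : ∀ h X → splits (map h X) ≡ map (mapSplit h) (splits X)
splits-map h []      = refl
splits-map h (x ∷ X) rewrite splits-map h X = sym (trans (List.map-++ (mapSplit h) (map (map₁ (x ∷_)) (splits X)) _)
  (cong₂ _++_ (trans (sym (List.map-∘ (splits X))) (List.map-∘ (splits X)))
              (trans (sym (List.map-∘ (splits X))) (List.map-∘ (splits X)))))

arrangementsOf-map : ∀ h f X → arrangementsOf f (map h X) ≡ map (map h) (arrangementsOf f X)
arrangementsOf-map h zero    X       = refl
arrangementsOf-map h (suc f) []      = refl
arrangementsOf-map h (suc f) (x ∷ X) = begin
    concatMap (arrangementsAround f (h x)) (splits (map h X))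
  ≡⟨ cong (concatMap (arrangementsAround f (h x))) (splits-map h X) ⟩
    concatMap (arrangementsAround f (h x)) (map (mapSplit h) (splits X))
  ≡⟨ List.concatMap-map (arrangementsAround f (h x)) (mapSplit h) (splits X) ⟩
    concatMap (arrangementsAround f (h x) ∘ mapSplit h) (splits X)
  ≡⟨ List.concatMap-cong around-map (splits X) ⟩
    concatMap (map (map h) ∘ arrangementsAround f x) (splits X)
  ≡⟨ List.map-concatMap (map h) (arrangementsAround f x) (splits X) ⟨
    map (map h) (concatMap (arrangementsAround f x) (splits X))
  ∎
  where
  open ≡-Reasoning
  glue-map : ∀ A B → glue (h x) (map h A) (map h B) ≡ map h (glue x A B)
  glue-map A B = sym (List.map-++ h A (x ∷ B))
  around-map : ∀ p → arrangementsAround f (h x) (mapSplit h p) ≡ map (map h) (arrangementsAround f x p)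
  around-map p = begin
      concatMap (λ A → map (glue (h x) A) (arrangementsOf f (map h (proj₂ p)))) (arrangementsOf f (map h (proj₁ p)))
    ≡⟨ cong₂ (λ L M → concatMap (λ A → map (glue (h x) A) M) L)
         (arrangementsOf-map h f (proj₁ p)) (arrangementsOf-map h f (proj₂ p)) ⟩
      concatMap (λ A → map (glue (h x) A) (map (map h) (arrangementsOf f (proj₂ p)))) (map (map h) (arrangementsOf f (proj₁ p)))
    ≡⟨ List.concatMap-map _ (map h) (arrangementsOf f (proj₁ p)) ⟩
      concatMap (λ A → map (glue (h x) (map h A)) (map (map h) (arrangementsOf f (proj₂ p)))) (arrangementsOf f (proj₁ p))
    ≡⟨ List.concatMap-cong (λ A → trans (sym (List.map-∘ (arrangementsOf f (proj₂ p))))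
         (trans (List.map-cong (glue-map A) (arrangementsOf f (proj₂ p))) (List.map-∘ (arrangementsOf f (proj₂ p)))))
         (arrangementsOf f (proj₁ p)) ⟩
      concatMap (λ A → map (map h) (map (glue x A) (arrangementsOf f (proj₂ p)))) (arrangementsOf f (proj₁ p))
    ≡⟨ List.map-concatMap (map h) (λ A → map (glue x A) (arrangementsOf f (proj₂ p))) (arrangementsOf f (proj₁ p)) ⟨
      map (map h) (arrangementsAround f x p)
    ∎

strictMono-by-steps : ∀ h → (∀ i → h i < h (suc i)) → h Preserves _<_ ⟶ _<_
strictMono-by-steps h step {a} {suc b} (s≤s a≤b) with ℕ.m≤n⇒m<n∨m≡n a≤b
... | inj₂ refl = step a
... | inj₁ a<b  = ℕ.<-trans (strictMono-by-steps h step a<b) (step b)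

-- The increasing relabelling i ↦ i-th entry of Y (and 0 ↦ p), extended past the end of Y by steps of 1;
-- it carries the arrangements of [1..length Y] to those of a sorted Y.
enumerate : ℕ → List ℕ → ℕ → ℕ
enumerate p []      i       = p ℕ.+ i
enumerate p (y ∷ Y) zero    = p
enumerate p (y ∷ Y) (suc i) = enumerate y Y i

p≤enumerate-0 : ∀ p Y → p ≤ enumerate p Y 0
p≤enumerate-0 p []      = ℕ.m≤m+n p 0
p≤enumerate-0 p (y ∷ Y) = ℕ.≤-refl

enumerate-step : ∀ p Y → SortedAbove p Y → ∀ i → enumerate p Y i < enumerate p Y (suc i)
enumerate-step p []      _            i rewrite ℕ.+-suc p i = ℕ.n<1+n (p ℕ.+ i)
enumerate-step p (y ∷ Y) (p<y , _)    zero    = ℕ.<-≤-trans p<y (p≤enumerate-0 y Y)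
enumerate-step p (y ∷ Y) (_ , sorted) (suc i) = enumerate-step y Y sorted i

enumerate-range : ∀ p Y → map (enumerate p Y) (range 1 (length Y)) ≡ Y
enumerate-range p []      = refl
enumerate-range p (y ∷ Y) = cong₂ _∷_ (enumerate-0 Y) (trans (shift 1 (length Y)) (enumerate-range y Y))
  where
  enumerate-0 : ∀ Y → enumerate y Y 0 ≡ y
  enumerate-0 []      = ℕ.+-identityʳ y
  enumerate-0 (_ ∷ _) = refl
  shift : ∀ s k → map (enumerate p (y ∷ Y)) (range (suc s) k) ≡ map (enumerate y Y) (range s k)
  shift s zero    = refl
  shift s (suc k) = cong (enumerate y Y s ∷_) (shift (suc s) k)

RelabelInvariant : (List ℕ → ℚ) → Set
RelabelInvariant u = ∀ h → h Preserves _<_ ⟶ _<_ → ∀ σ → u (map h σ) ≡ u σ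

∑-arrangementsOf-standardise : ∀ u → RelabelInvariant u → ∀ f Y → SortedAbove 0 Y → length Y ≤ f →
  ∑ (arrangementsOf f Y) u ≡ ∑ (arrangements (length Y)) u
∑-arrangementsOf-standardise u u-inv f Y sorted Y≤f = begin
    ∑ (arrangementsOf f Y) u                  ≡⟨ cong (λ L → ∑ (arrangementsOf f L) u) (sym (enumerate-range 0 Y)) ⟩
    ∑ (arrangementsOf f (map h R)) u          ≡⟨ cong (λ L → ∑ L u) (arrangementsOf-map h f R) ⟩
    ∑ (map (map h) (arrangementsOf f R)) u    ≡⟨ ∑-map (map h) (arrangementsOf f R) u ⟩
    ∑ (arrangementsOf f R) (u ∘ map h)        ≡⟨ ∑-cong (arrangementsOf f R) _ _ (λ {σ} _ → u-inv h h-mono σ) ⟩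
    ∑ (arrangementsOf f R) u                  ≡⟨ cong (λ L → ∑ L u) (arrangementsOf-fuel f R R≤f) ⟩
    ∑ (arrangementsOf (length R) R) u         ≡⟨ cong (λ k → ∑ (arrangementsOf k R) u) (length-range 1 (length Y)) ⟩
    ∑ (arrangements (length Y)) u             ∎
  where
  open ≡-Reasoning
  R = range 1 (length Y)
  h = enumerate 0 Y
  h-mono : h Preserves _<_ ⟶ _<_
  h-mono = strictMono-by-steps h (enumerate-step 0 Y sorted)
  R≤f : length R ≤ f
  R≤f = subst (_≤ f) (sym (length-range 1 (length Y))) Y≤f

∑-arrangements-suc : ∀ n (g : List ℕ → ℚ) (F : ℕ → ℕ → ℚ) →
  (∀ {p} → p ∈ splits (range 2 n) →
    ∑ (arrangementsOf n (proj₁ p)) (λ A → ∑ (arrangementsOf n (proj₂ p)) (λ B → g (glue 1 A B)))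
      ≡ F (length (proj₁ p)) (length (proj₂ p))) →
  ∑ (arrangements (suc n)) g ≡ conv n F
∑-arrangements-suc n g F split-sum = begin
    ∑ (concatMap (arrangementsAround n 1) (splits (range 2 n))) g
  ≡⟨ ∑-concatMap (arrangementsAround n 1) (splits (range 2 n)) g ⟩
    ∑ (splits (range 2 n)) (λ p → ∑ (arrangementsAround n 1 p) g)
  ≡⟨ ∑-cong (splits (range 2 n)) _ _ (λ {p} p∈ → trans (∑-concatMap _ (arrangementsOf n (proj₁ p)) g)
       (trans (∑-cong (arrangementsOf n (proj₁ p)) _ _ (λ {A} _ → ∑-map (glue 1 A) (arrangementsOf n (proj₂ p)) g))
              (split-sum p∈))) ⟩
    ∑ (splits (range 2 n)) (λ p → F (length (proj₁ p)) (length (proj₂ p)))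
  ≡⟨ ∑-splits (range 2 n) F ⟩
    conv (length (range 2 n)) F
  ≡⟨ cong (λ k → conv k F) (length-range 2 n) ⟩
    conv n F
  ∎
  where open ≡-Reasoning

module _ (n : ℕ) {p : Split} (p∈ : p ∈ splits (range 2 n)) where

  private
    parts-sorted : SortedAbove 1 (proj₁ p) × SortedAbove 1 (proj₂ p)
    parts-sorted = splits-sorted (range 2 n) p∈ (range-sorted 1 2 n ℕ.≤-refl)

    left≤n : length (proj₁ p) ≤ n
    left≤n = subst (length (proj₁ p) ≤_) (length-range 2 n) (length-splitˡ-≤ (range 2 n) p∈)

    right≤n : length (proj₂ p) ≤ n
    right≤n = subst (length (proj₂ p) ≤_) (length-range 2 n) (length-splitʳ-≤ (range 2 n) p∈)

  arrangementsOf-left-above-1 : ∀ {A} → A ∈ arrangementsOf n (proj₁ p) → Above 1 A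
  arrangementsOf-left-above-1 A∈ z∈A =
    SortedAbove⇒Above (proj₁ p) (proj₁ parts-sorted) (arrangementsOf-⊆ n (proj₁ p) A∈ z∈A)

  arrangementsOf-right-above-1 : ∀ {B} → B ∈ arrangementsOf n (proj₂ p) → Above 1 B
  arrangementsOf-right-above-1 B∈ z∈B =
    SortedAbove⇒Above (proj₂ p) (proj₂ parts-sorted) (arrangementsOf-⊆ n (proj₂ p) B∈ z∈B)

  ∑-split-product : ∀ u v → RelabelInvariant u → RelabelInvariant v →
    ∑ (arrangementsOf n (proj₁ p)) (λ A → ∑ (arrangementsOf n (proj₂ p)) (λ B → u A * v B))
      ≡ ∑ (arrangements (length (proj₁ p))) u * ∑ (arrangements (length (proj₂ p))) v
  ∑-split-product u v u-inv v-inv = trans (∑-product (arrangementsOf n (proj₁ p)) (arrangementsOf n (proj₂ p)) u v)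
    (cong₂ _*_
      (∑-arrangementsOf-standardise u u-inv n (proj₁ p) (SortedAbove-weaken (proj₁ p) z≤n (proj₁ parts-sorted)) left≤n)
      (∑-arrangementsOf-standardise v v-inv n (proj₂ p) (SortedAbove-weaken (proj₂ p) z≤n (proj₂ parts-sorted)) right≤n))

∑-arrangements-suc-factor : ∀ n (g u v : List ℕ → ℚ) → RelabelInvariant u → RelabelInvariant v →
  (∀ A B → Above 1 A → Above 1 B → g (glue 1 A B) ≡ u A * v B) →
  ∑ (arrangements (suc n)) g ≡ conv n (λ i j → ∑ (arrangements i) u * ∑ (arrangements j) v)
∑-arrangements-suc-factor n g u v u-inv v-inv g-factor = ∑-arrangements-suc n g _ λ {p} p∈ →
  trans (∑-cong (arrangementsOf n (proj₁ p)) _ _ (λ A∈ → ∑-cong (arrangementsOf n (proj₂ p)) _ _ (λ B∈ →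
          g-factor _ _ (arrangementsOf-left-above-1 n p∈ A∈) (arrangementsOf-right-above-1 n p∈ B∈))))
        (∑-split-product n p∈ u v u-inv v-inv)

∑-arrangements-suc-factor₂ : ∀ n (g u₁ v₁ u₂ v₂ : List ℕ → ℚ) →
  RelabelInvariant u₁ → RelabelInvariant v₁ → RelabelInvariant u₂ → RelabelInvariant v₂ →
  (∀ A B → Above 1 A → Above 1 B → g (glue 1 A B) ≡ u₁ A * v₁ B + u₂ A * v₂ B) →
  ∑ (arrangements (suc n)) g
    ≡ conv n (λ i j → ∑ (arrangements i) u₁ * ∑ (arrangements j) v₁ + ∑ (arrangements i) u₂ * ∑ (arrangements j) v₂)
∑-arrangements-suc-factor₂ n g u₁ v₁ u₂ v₂ u₁-inv v₁-inv u₂-inv v₂-inv g-factor = ∑-arrangements-suc n g _ λ {p} p∈ →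
  trans (∑-cong (arrangementsOf n (proj₁ p)) _ _ (λ A∈ →
          trans (∑-cong (arrangementsOf n (proj₂ p)) _ _ (λ B∈ →
                   g-factor _ _ (arrangementsOf-left-above-1 n p∈ A∈) (arrangementsOf-right-above-1 n p∈ B∈)))
                (∑-+ (arrangementsOf n (proj₂ p)) _ _)))
  (trans (∑-+ (arrangementsOf n (proj₁ p)) _ _)
         (cong₂ _+_ (∑-split-product n p∈ u₁ v₁ u₁-inv v₁-inv) (∑-split-product n p∈ u₂ v₂ u₂-inv v₂-inv)))

-- Arrangements enumerate the permutations

module _ {A : Set} where

  ∈-delete : ∀ (ys : List A) {zs x z} → z ∈ ys ++ x ∷ zs → ¬ z ≡ x → z ∈ ys ++ zs
  ∈-delete []       (here z≡x) z≢x = ⊥-elim (z≢x z≡x)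
  ∈-delete []       (there z∈) _   = z∈
  ∈-delete (y ∷ ys) (here z≡y) _   = here z≡y
  ∈-delete (y ∷ ys) (there z∈) z≢x = there (∈-delete ys z∈ z≢x)

  unique-⊆⇒length≤ : ∀ {xs ys : List A} → Unique xs → xs ⊆ ys → length xs ≤ length ys
  unique-⊆⇒length≤ {[]}     _             _     = z≤n
  unique-⊆⇒length≤ {x ∷ xs} (x∉xs ∷ uxs) xs⊆ys with ∈-∃++ (xs⊆ys (here refl))
  ... | ys , zs , refl = begin
      suc (length xs)            ≤⟨ s≤s (unique-⊆⇒length≤ uxs xs⊆ys∖x) ⟩
      suc (length (ys ++ zs))    ≡⟨ cong suc (List.length-++ ys) ⟩
      suc (length ys ℕ.+ length zs) ≡⟨ ℕ.+-suc (length ys) (length zs) ⟨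
      length ys ℕ.+ length (x ∷ zs) ≡⟨ List.length-++ ys ⟨
      length (ys ++ x ∷ zs)      ∎
    where
    open ℕ.≤-Reasoning
    xs⊆ys∖x : xs ⊆ ys ++ zs
    xs⊆ys∖x z∈xs = ∈-delete ys (xs⊆ys (there z∈xs)) (λ z≡x → All¬⇒¬Any x∉xs (subst (_∈ xs) z≡x z∈xs))

  Unique-++-∷⁻ : ∀ (xs : List A) {x ys} → Unique (xs ++ x ∷ ys) →
    Unique xs × Unique ys × x ∉ xs × x ∉ ys × (∀ {z} → z ∈ xs → z ∈ ys → ⊥)
  Unique-++-∷⁻ []       (x∉ys ∷ uys) = [] , uys , (λ ()) , All¬⇒¬Any x∉ys , (λ ())
  Unique-++-∷⁻ (a ∷ xs) {x} {ys} (a∉ ∷ u) with Unique-++-∷⁻ xs u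
  ... | uxs , uys , x∉xs , x∉ys , disjoint =
    (¬Any⇒All¬ xs (λ a∈xs → All¬⇒¬Any a∉ (∈-++⁺ˡ a∈xs)) ∷ uxs) , uys ,
    (λ { (here x≡a) → All¬⇒¬Any a∉ (∈-++⁺ʳ xs (here (sym x≡a))) ; (there x∈xs) → x∉xs x∈xs }) ,
    x∉ys ,
    (λ { (here refl) z∈ys → All¬⇒¬Any a∉ (∈-++⁺ʳ xs (there z∈ys)) ; (there z∈xs) z∈ys → disjoint z∈xs z∈ys })

  Unique-concatMap : ∀ {B : Set} (F : A → List B) {xs : List A} → Unique xs → (∀ {x} → x ∈ xs → Unique (F x)) →
    (∀ {x x′ y} → x ∈ xs → x′ ∈ xs → y ∈ F x → y ∈ F x′ → x ≡ x′) → Unique (concatMap F xs)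
  Unique-concatMap F {[]}     _              _        _         = []
  Unique-concatMap F {x ∷ xs} (x∉xs ∷ uxs) F-unique F-disjoint = Unique.++⁺ (F-unique (here refl))
    (Unique-concatMap F uxs (F-unique ∘ there) (λ x∈ x′∈ → F-disjoint (there x∈) (there x′∈)))
    (λ (y∈Fx , y∈rest) → let (x′ , x′∈ , y∈Fx′) = find (∈-concatMap⁻ F {xs = xs} y∈rest) in
       All¬⇒¬Any x∉xs (subst (_∈ xs) (sym (F-disjoint (here refl) (there x′∈) y∈Fx y∈Fx′)) x′∈))

unique-⊆-length≡⇒⊇ : ∀ {A Y : List ℕ} → Unique A → length A ≡ length Y → A ⊆ Y → Y ⊆ A
unique-⊆-length≡⇒⊇ {A} {Y} uA A≡Y A⊆Y {z} z∈Y with z ∈? A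
... | yes z∈A = z∈A
... | no  z∉A = ⊥-elim (ℕ.<-irrefl refl (subst (suc (length A) ≤_) (sym A≡Y)
  (unique-⊆⇒length≤ {xs = z ∷ A} (¬Any⇒All¬ A z∉A ∷ uA) λ { (here refl) → z∈Y ; (there w∈A) → A⊆Y w∈A })))

splits-unique : ∀ X → Unique X → Unique (splits X)
splits-unique []      _             = [] ∷ []
splits-unique (x ∷ X) (x∉X ∷ uX) = Unique.++⁺
  (Unique.map⁺ (λ e → cong₂ _,_ (List.∷-injectiveʳ (cong proj₁ e)) (cong proj₂ e)) (splits-unique X uX))
  (Unique.map⁺ (λ e → cong₂ _,_ (cong proj₁ e) (List.∷-injectiveʳ (cong proj₂ e))) (splits-unique X uX))
  (λ (p∈ˡ , p∈ʳ) → let (q , _ , p≡q) = ∈-map⁻ (map₁ (x ∷_)) p∈ˡ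
                       (r , r∈ , p≡r) = ∈-map⁻ (map₂ (x ∷_)) p∈ʳ
                   in All¬⇒¬Any x∉X (splitˡ-⊆ X r∈ (subst (x ∈_) (cong proj₁ (trans (sym p≡q) p≡r)) (here refl))))

split-unique : ∀ X {p} → Unique X → p ∈ splits X →
  Unique (proj₁ p) × Unique (proj₂ p) × (∀ {z} → z ∈ proj₁ p → z ∈ proj₂ p → ⊥)
split-unique []      _            (here refl) = [] , [] , λ ()
split-unique (x ∷ X) (x∉X ∷ uX) p∈ with ∈-splits⁻ {x} {X} p∈
... | q , q∈ , inj₁ refl with split-unique X uX q∈
...   | uY , uZ , disjoint =
  (¬Any⇒All¬ (proj₁ q) (All¬⇒¬Any x∉X ∘ splitˡ-⊆ X q∈) ∷ uY) , uZ ,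
  (λ { (here refl) z∈Z → All¬⇒¬Any x∉X (splitʳ-⊆ X q∈ z∈Z) ; (there z∈Y) z∈Z → disjoint z∈Y z∈Z })
split-unique (x ∷ X) (x∉X ∷ uX) p∈ | q , q∈ , inj₂ refl with split-unique X uX q∈
...   | uY , uZ , disjoint =
  uY , (¬Any⇒All¬ (proj₂ q) (All¬⇒¬Any x∉X ∘ splitʳ-⊆ X q∈) ∷ uZ) ,
  (λ { z∈Y (here refl) → All¬⇒¬Any x∉X (splitˡ-⊆ X q∈ z∈Y) ; z∈Y (there z∈Z) → disjoint z∈Y z∈Z })

filter-∈-splits : ∀ (A : List ℕ) X → (filter (_∈? A) X , filter (λ z → ¬? (z ∈? A)) X) ∈ splits X
filter-∈-splits A []      = here refl
filter-∈-splits A (x ∷ X) with x ∈? A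
... | yes _ = ∈-++⁺ˡ (∈-map⁺ (map₁ (x ∷_)) (filter-∈-splits A X))
... | no  _ = ∈-++⁺ʳ (map (map₁ (x ∷_)) (splits X)) (∈-map⁺ (map₂ (x ∷_)) (filter-∈-splits A X))

splits-determinedˡ : ∀ X {p p′} → Unique X → p ∈ splits X → p′ ∈ splits X →
  proj₁ p ⊆ proj₁ p′ → proj₁ p′ ⊆ proj₁ p → p ≡ p′
splits-determinedˡ []      _            (here refl) (here refl) _ _ = refl
splits-determinedˡ (x ∷ X) (x∉X ∷ uX) p∈ p′∈ ⊆₁ ⊆₂ with ∈-splits⁻ {x} {X} p∈ | ∈-splits⁻ {x} {X} p′∈
... | q , q∈ , inj₁ refl | q′ , q′∈ , inj₁ refl =
  cong (map₁ (x ∷_)) (splits-determinedˡ X uX q∈ q′∈ (drop-x q∈ ⊆₁) (drop-x q′∈ ⊆₂))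
  where
  drop-x : ∀ {r Y′} → r ∈ splits X → (x ∷ proj₁ r) ⊆ (x ∷ Y′) → proj₁ r ⊆ Y′
  drop-x r∈ ⊆x {z} z∈ with ⊆x (there z∈)
  ... | here refl = ⊥-elim (All¬⇒¬Any x∉X (splitˡ-⊆ X r∈ z∈))
  ... | there z∈′ = z∈′
... | q , q∈ , inj₁ refl | q′ , q′∈ , inj₂ refl = ⊥-elim (All¬⇒¬Any x∉X (splitˡ-⊆ X q′∈ (⊆₁ (here refl))))
... | q , q∈ , inj₂ refl | q′ , q′∈ , inj₁ refl = ⊥-elim (All¬⇒¬Any x∉X (splitˡ-⊆ X q∈ (⊆₂ (here refl))))
... | q , q∈ , inj₂ refl | q′ , q′∈ , inj₂ refl = cong (map₂ (x ∷_)) (splits-determinedˡ X uX q∈ q′∈ ⊆₁ ⊆₂)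

glue-injectiveˡ : ∀ (A A′ : List ℕ) {x B B′} → x ∉ A → x ∉ A′ → glue x A B ≡ glue x A′ B′ → A ≡ A′
glue-injectiveˡ []      []        _   _    _ = refl
glue-injectiveˡ []      (a′ ∷ A′) _   x∉A′ e = ⊥-elim (x∉A′ (here (List.∷-injectiveˡ e)))
glue-injectiveˡ (a ∷ A) []        x∉A _    e = ⊥-elim (x∉A (here (sym (List.∷-injectiveˡ e))))
glue-injectiveˡ (a ∷ A) (a′ ∷ A′) x∉A x∉A′ e =
  cong₂ _∷_ (List.∷-injectiveˡ e) (glue-injectiveˡ A A′ (x∉A ∘ there) (x∉A′ ∘ there) (List.∷-injectiveʳ e))


∈-arrangementsOf⇒Unique : ∀ f X {σ} → Unique X → length X ≤ f → σ ∈ arrangementsOf f X → Unique σ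
∈-arrangementsOf⇒Unique zero    X       _             _         (here refl) = []
∈-arrangementsOf⇒Unique (suc f) []      _             _         (here refl) = []
∈-arrangementsOf⇒Unique (suc f) (x ∷ X) (x∉X ∷ uX) (s≤s X≤f) σ∈ with ∈-arrangementsOf⁻ f x X σ∈
... | p , p∈ , A , A∈ , B , B∈ , refl with split-unique X uX p∈
...   | uY , uZ , disjoint = Unique.++⁺ uA (¬Any⇒All¬ B x∉B ∷ uB) λ where
          (z∈A , here refl)  → All¬⇒¬Any x∉X (splitˡ-⊆ X p∈ (arrangementsOf-⊆ f (proj₁ p) A∈ z∈A))
          (z∈A , there z∈B) → disjoint (arrangementsOf-⊆ f (proj₁ p) A∈ z∈A) (arrangementsOf-⊆ f (proj₂ p) B∈ z∈B)
  where
  uA = ∈-arrangementsOf⇒Unique f (proj₁ p) uY (ℕ.≤-trans (length-splitˡ-≤ X p∈) X≤f) A∈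
  uB = ∈-arrangementsOf⇒Unique f (proj₂ p) uZ (ℕ.≤-trans (length-splitʳ-≤ X p∈) X≤f) B∈
  x∉B : x ∉ B
  x∉B x∈B = All¬⇒¬Any x∉X (splitʳ-⊆ X p∈ (arrangementsOf-⊆ f (proj₂ p) B∈ x∈B))

m≤o∧n≤p∧m+n≡o+p⇒m≡o : ∀ {a y b z} → a ≤ y → b ≤ z → a ℕ.+ b ≡ y ℕ.+ z → a ≡ y
m≤o∧n≤p∧m+n≡o+p⇒m≡o {a} {y} {b} {z} a≤y b≤z a+b≡y+z with ℕ.m≤n⇒m<n∨m≡n a≤y
... | inj₂ a≡y = a≡y
... | inj₁ a<y = ⊥-elim (ℕ.<-irrefl a+b≡y+z (ℕ.+-mono-<-≤ a<y b≤z))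

-- σ = A x B comes from the split of X into the letters in A and the others; since the letters are
-- distinct, counting shows the parts have the lengths of A and B.
arrangementsOf-complete : ∀ f X {σ} → Unique X → length X ≤ f → Unique σ → length σ ≡ length X → σ ⊆ X → σ ∈ arrangementsOf f X
arrangementsOf-complete zero    []      {[]} _        _         _  _    _    = here refl
arrangementsOf-complete (suc f) []      {[]} _        _         _  _    _    = here refl
arrangementsOf-complete (suc f) (x ∷ X) {σ} (x∉X ∷ uX) (s≤s X≤f) uσ σ≡X σ⊆X with ∈-∃++ x∈σ
  where
  x∈σ : x ∈ σ
  x∈σ with x ∈? σ
  ... | yes x∈σ = x∈σ
  ... | no  x∉σ = ⊥-elim (ℕ.<-irrefl refl (subst (_≤ length X) σ≡X (unique-⊆⇒length≤ uσ σ⊆X∖x)))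
    where
    σ⊆X∖x : σ ⊆ X
    σ⊆X∖x z∈σ with σ⊆X z∈σ
    ... | here refl = ⊥-elim (x∉σ z∈σ)
    ... | there z∈X = z∈X
... | A , B , refl with Unique-++-∷⁻ A uσ
...   | uA , uB , x∉A , x∉B , disjoint = ∈-arrangementsOf⁺ f x X p∈ A∈ B∈
  where
  Y = filter (_∈? A) X
  Z = filter (λ z → ¬? (z ∈? A)) X
  p∈ = filter-∈-splits A X
  A⊆Y : A ⊆ Y
  A⊆Y z∈A with σ⊆X (∈-++⁺ˡ z∈A)
  ... | here refl = ⊥-elim (x∉A z∈A)
  ... | there z∈X = ∈-filter⁺ (_∈? A) z∈X z∈A
  B⊆Z : B ⊆ Z
  B⊆Z z∈B with σ⊆X (∈-++⁺ʳ A (there z∈B))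
  ... | here refl = ⊥-elim (x∉B z∈B)
  ... | there z∈X = ∈-filter⁺ (λ z → ¬? (z ∈? A)) z∈X (λ z∈A → disjoint z∈A z∈B)
  uY = Unique.filter⁺ (_∈? A) uX
  uZ = Unique.filter⁺ (λ z → ¬? (z ∈? A)) uX
  A+B≡Y+Z : length A ℕ.+ length B ≡ length Y ℕ.+ length Z
  A+B≡Y+Z = trans (ℕ.suc-injective (trans (sym (ℕ.+-suc (length A) (length B))) (trans (sym (List.length-++ A)) σ≡X)))
                  (sym (length-split X p∈))
  A≡Y : length A ≡ length Y
  A≡Y = m≤o∧n≤p∧m+n≡o+p⇒m≡o (unique-⊆⇒length≤ uA A⊆Y) (unique-⊆⇒length≤ uB B⊆Z) A+B≡Y+Z
  B≡Z : length B ≡ length Z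
  B≡Z = m≤o∧n≤p∧m+n≡o+p⇒m≡o (unique-⊆⇒length≤ uB B⊆Z) (unique-⊆⇒length≤ uA A⊆Y)
          (trans (ℕ.+-comm (length B) (length A)) (trans A+B≡Y+Z (ℕ.+-comm (length Y) (length Z))))
  A∈ = arrangementsOf-complete f Y uY (ℕ.≤-trans (length-splitˡ-≤ X p∈) X≤f) uA A≡Y A⊆Y
  B∈ = arrangementsOf-complete f Z uZ (ℕ.≤-trans (length-splitʳ-≤ X p∈) X≤f) uB B≡Z B⊆Z

arrangementsOf-unique : ∀ f X → Unique X → length X ≤ f → Unique (arrangementsOf f X)
arrangementsOf-unique zero    X       _             _         = [] ∷ []
arrangementsOf-unique (suc f) []      _             _         = [] ∷ []
arrangementsOf-unique (suc f) (x ∷ X) (x∉X ∷ uX) (s≤s X≤f) =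
  Unique-concatMap (arrangementsAround f x) (splits-unique X uX) around-unique around-disjoint
  where
  left≤f : ∀ {p} → p ∈ splits X → length (proj₁ p) ≤ f
  left≤f p∈ = ℕ.≤-trans (length-splitˡ-≤ X p∈) X≤f
  x∉A : ∀ {p A} → p ∈ splits X → A ∈ arrangementsOf f (proj₁ p) → x ∉ A
  x∉A {p} p∈ A∈ x∈A = All¬⇒¬Any x∉X (splitˡ-⊆ X p∈ (arrangementsOf-⊆ f (proj₁ p) A∈ x∈A))
  around-unique : ∀ {p} → p ∈ splits X → Unique (arrangementsAround f x p)
  around-unique {p} p∈ with split-unique X uX p∈
  ... | uY , uZ , _ = Unique-concatMap (λ A → map (glue x A) (arrangementsOf f (proj₂ p)))
    (arrangementsOf-unique f (proj₁ p) uY (left≤f p∈))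
    (λ {A} _ → Unique.map⁺ (λ e → List.∷-injectiveʳ (List.++-cancelˡ A _ _ e))
                 (arrangementsOf-unique f (proj₂ p) uZ (ℕ.≤-trans (length-splitʳ-≤ X p∈) X≤f)))
    (λ {A} {A′} A∈ A′∈ σ∈ σ∈′ → let (B , _ , σ≡) = ∈-map⁻ (glue x A) σ∈
                                    (B′ , _ , σ≡′) = ∈-map⁻ (glue x A′) σ∈′
                                in glue-injectiveˡ A A′ (x∉A p∈ A∈) (x∉A p∈ A′∈) (trans (sym σ≡) σ≡′))
  glued : ∀ {p σ} → σ ∈ arrangementsAround f x p →
    Σ (List ℕ) λ A → A ∈ arrangementsOf f (proj₁ p) × Σ (List ℕ) λ B → σ ≡ glue x A B
  glued {p} σ∈ =
    let (A , A∈ , σ∈A) = find (∈-concatMap⁻ (λ A → map (glue x A) (arrangementsOf f (proj₂ p))) {xs = arrangementsOf f (proj₁ p)} σ∈)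
        (B , _ , σ≡) = ∈-map⁻ (glue x A) σ∈A
    in A , A∈ , B , σ≡
  left⊆ : ∀ {p A} → p ∈ splits X → A ∈ arrangementsOf f (proj₁ p) → proj₁ p ⊆ A
  left⊆ {p} p∈ A∈ = unique-⊆-length≡⇒⊇
    (∈-arrangementsOf⇒Unique f (proj₁ p) (proj₁ (split-unique X uX p∈)) (left≤f p∈) A∈)
    (length-arrangementsOf f (proj₁ p) (left≤f p∈) A∈) (arrangementsOf-⊆ f (proj₁ p) A∈)
  around-disjoint : ∀ {p p′ σ} → p ∈ splits X → p′ ∈ splits X →
    σ ∈ arrangementsAround f x p → σ ∈ arrangementsAround f x p′ → p ≡ p′
  around-disjoint {p} {p′} p∈ p′∈ σ∈ σ∈′ with glued {p} σ∈ | glued {p′} σ∈′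
  ... | A , A∈ , B , σ≡ | A′ , A′∈ , B′ , σ≡′ with glue-injectiveˡ A A′ (x∉A p∈ A∈) (x∉A p′∈ A′∈) (trans (sym σ≡) σ≡′)
  ...   | refl = splits-determinedˡ X uX p∈ p′∈
          (arrangementsOf-⊆ f (proj₁ p′) A′∈ ∘ left⊆ p∈ A∈) (arrangementsOf-⊆ f (proj₁ p) A∈ ∘ left⊆ p′∈ A′∈)

∈-range⁻ : ∀ s k {z} → z ∈ range s k → s ≤ z × z < s ℕ.+ k
∈-range⁻ s (suc k) (here refl) = ℕ.≤-refl , ℕ.m<m+n s (s≤s z≤n)
∈-range⁻ s (suc k) {z} (there z∈) with ∈-range⁻ (suc s) k z∈
... | s<z , z<s+k = ℕ.<⇒≤ s<z , subst (z <_) (sym (ℕ.+-suc s k)) z<s+k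

∈-range⁺ : ∀ s k {z} → s ≤ z → z < s ℕ.+ k → z ∈ range s k
∈-range⁺ s zero    {z} s≤z z<s = ⊥-elim (ℕ.<⇒≱ z<s (subst (_≤ z) (sym (ℕ.+-identityʳ s)) s≤z))
∈-range⁺ s (suc k) {z} s≤z z<s+k with z ≟ s
... | yes refl = here refl
... | no  z≢s  = there (∈-range⁺ (suc s) k (ℕ.≤∧≢⇒< s≤z (z≢s ∘ sym)) (subst (z <_) (ℕ.+-suc s k) z<s+k))

range-unique : ∀ s k → Unique (range s k)
range-unique s zero    = []
range-unique s (suc k) = ¬Any⇒All¬ _ (λ s∈ → ℕ.<⇒≱ (proj₁ (∈-range⁻ (suc s) k s∈)) ℕ.≤-refl) ∷ range-unique (suc s) k

words-unique : ∀ m k → Unique (words m k)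
words-unique m zero    = [] ∷ []
words-unique m (suc k) = Unique-concatMap (λ w → map (λ i → suc i ∷ w) (upTo m)) (words-unique m k)
  (λ _ → Unique.map⁺ (λ e → ℕ.suc-injective (List.∷-injectiveˡ e)) (Unique.upTo⁺ m))
  (λ {w} {w′} _ _ σ∈ σ∈′ → let (_ , _ , σ≡) = ∈-map⁻ (λ i → suc i ∷ w) σ∈
                               (_ , _ , σ≡′) = ∈-map⁻ (λ i → suc i ∷ w′) σ∈′
                           in List.∷-injectiveʳ (trans (sym σ≡) σ≡′))

∈-words⁻ : ∀ m k {σ} → σ ∈ words m k → length σ ≡ k × σ ⊆ range 1 m
∈-words⁻ m zero    (here refl) = refl , λ ()
∈-words⁻ m (suc k) σ∈ with find (∈-concatMap⁻ (λ w → map (λ i → suc i ∷ w) (upTo m)) {xs = words m k} σ∈)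
... | w , w∈ , σ∈w with ∈-map⁻ (λ i → suc i ∷ w) σ∈w
...   | i , i∈ , refl with ∈-words⁻ m k w∈
...     | w≡k , w⊆ = cong suc w≡k , λ where
          (here refl) → ∈-range⁺ 1 m (s≤s z≤n) (s≤s (∈-upTo⁻ i∈))
          (there z∈w) → w⊆ z∈w

∈-words⁺ : ∀ m k σ → length σ ≡ k → σ ⊆ range 1 m → σ ∈ words m k
∈-words⁺ m zero    []      _   _  = here refl
∈-words⁺ m (suc k) (z ∷ σ) σ≡k σ⊆ with ∈-range⁻ 1 m (σ⊆ (here refl))
... | s≤s _ , s≤s z≤m =
  ∈-concatMap⁺ (λ w → map (λ i → suc i ∷ w) (upTo m)) {xs = words m k}
    (lose (∈-words⁺ m k σ (ℕ.suc-injective σ≡k) (σ⊆ ∘ there)) (∈-map⁺ (λ i → suc i ∷ σ) (∈-upTo⁺ z≤m)))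

∈-Perms⁻ : ∀ m {σ} → σ ∈ Perms m → Unique σ × length σ ≡ m × σ ⊆ range 1 m
∈-Perms⁻ m σ∈ with ∈-filter⁻ unique? {xs = words m m} σ∈
... | σ∈words , uσ = uσ , ∈-words⁻ m m σ∈words

∈-Perms⁺ : ∀ m {σ} → Unique σ → length σ ≡ m → σ ⊆ range 1 m → σ ∈ Perms m
∈-Perms⁺ m {σ} uσ σ≡m σ⊆ = ∈-filter⁺ unique? {xs = words m m} (∈-words⁺ m m σ σ≡m σ⊆) uσ

Perms-unique : ∀ m → Unique (Perms m)
Perms-unique m = Unique.filter⁺ unique? (words-unique m m)

Perms↭arrangements : ∀ m → Perms m ↭ arrangements m
Perms↭arrangements m = ∼bag⇒↭ (unique∧set⇒bag (Perms-unique m) (arrangementsOf-unique m R (range-unique 1 m) R≤m)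
  (mk⇔ to from))
  where
  R = range 1 m
  R≤m : length R ≤ m
  R≤m = ℕ.≤-reflexive (length-range 1 m)
  to : ∀ {σ} → σ ∈ Perms m → σ ∈ arrangements m
  to σ∈ with ∈-Perms⁻ m σ∈
  ... | uσ , σ≡m , σ⊆ = arrangementsOf-complete m R (range-unique 1 m) R≤m uσ (trans σ≡m (sym (length-range 1 m))) σ⊆
  from : ∀ {σ} → σ ∈ arrangements m → σ ∈ Perms m
  from σ∈ = ∈-Perms⁺ m (∈-arrangementsOf⇒Unique m R (range-unique 1 m) R≤m σ∈) (length-arrangements m σ∈)
    (arrangementsOf-⊆ m R σ∈)

-- The weighted sums

pow-+ : ∀ q m n → pow q (m ℕ.+ n) ≡ pow q m * pow q n
pow-+ q zero    n = sym (*-identityˡ _)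
pow-+ q (suc m) n = trans (cong (q *_) (pow-+ q m n)) (sym (*-assoc q (pow q m) (pow q n)))

𝟙 : Bool → ℚ
𝟙 b = if b then 1ℚ else 0ℚ

if-∧ : ∀ a b x → (if a ∧ b then x else 0ℚ) ≡ 𝟙 a * (if b then x else 0ℚ)
if-∧ true  b x = sym (*-identityˡ (if b then x else 0ℚ))
if-∧ false b x = sym (*-zeroˡ (if b then x else 0ℚ))

if-* : ∀ b k x → (if b then k * x else 0ℚ) ≡ k * (if b then x else 0ℚ)
if-* true  k x = refl
if-* false k x = sym (*-zeroʳ k)

oddᶜ-length : ∀ A → oddᶜ (length A) ≡ 𝟙 (oddLength A)
oddᶜ-length []          = refl
oddᶜ-length (_ ∷ [])    = refl
oddᶜ-length (_ ∷ _ ∷ A) = oddᶜ-length A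

RelabelInvariant-length : ∀ (φ : ℕ → ℚ) → RelabelInvariant (λ σ → φ (length σ))
RelabelInvariant-length φ h _ σ = cong φ (List.length-map h σ)

RelabelInvariant-const : ∀ k → RelabelInvariant (λ _ → k)
RelabelInvariant-const k _ _ _ = refl

RelabelInvariant-* : ∀ {u v} → RelabelInvariant u → RelabelInvariant v → RelabelInvariant (λ σ → u σ * v σ)
RelabelInvariant-* u-inv v-inv h h-mono σ = cong₂ _*_ (u-inv h h-mono σ) (v-inv h h-mono σ)

∑-arrangements-length-* : ∀ i (φ : ℕ → ℚ) w → ∑ (arrangements i) (λ σ → φ (length σ) * w σ) ≡ φ i * ∑ (arrangements i) w
∑-arrangements-length-* i φ w = trans (∑-cong (arrangements i) _ _ (λ {σ} σ∈ → cong (λ k → φ k * w σ) (length-arrangements i σ∈)))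
  (∑-*ˡ (arrangements i) w (φ i))

∑-arrangements-δ : ∀ i → ∑ (arrangements i) (λ σ → δ (length σ)) ≡ δ i
∑-arrangements-δ zero    = refl
∑-arrangements-δ (suc i) = begin
  ∑ (arrangements (suc i)) (λ σ → δ (length σ))        ≡⟨ ∑-cong (arrangements (suc i)) _ _ (λ _ → sym (*-identityʳ _)) ⟩
  ∑ (arrangements (suc i)) (λ σ → δ (length σ) * 1ℚ)   ≡⟨ ∑-arrangements-length-* (suc i) δ (λ _ → 1ℚ) ⟩
  0ℚ * ∑ (arrangements (suc i)) (λ _ → 1ℚ)            ≡⟨ *-zeroˡ (∑ (arrangements (suc i)) (λ _ → 1ℚ)) ⟩
  0ℚ                                                   ∎
  where open ≡-Reasoning

sgn : List ℕ → ℚ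
sgn σ = pow (- 1ℚ) (des σ)

sgn-split : ∀ A B → Above 1 A → Above 1 B → sgn (glue 1 A B) ≡ (ε (length A) * sgn A) * sgn B
sgn-split A B 1<A 1<B = begin
    pow (- 1ℚ) (des (A ++ 1 ∷ B))
  ≡⟨ cong (pow (- 1ℚ)) (des-split A B 1<A 1<B) ⟩
    pow (- 1ℚ) (des A ℕ.+ (if null A then 0 else 1) ℕ.+ des B)
  ≡⟨ trans (pow-+ (- 1ℚ) (des A ℕ.+ (if null A then 0 else 1)) (des B)) (cong (_* sgn B) (pow-+ (- 1ℚ) (des A) (if null A then 0 else 1))) ⟩
    (sgn A * pow (- 1ℚ) (if null A then 0 else 1)) * sgn B
  ≡⟨ cong (λ z → (sgn A * z) * sgn B) (ε-length A) ⟨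
    (sgn A * ε (length A)) * sgn B
  ≡⟨ cong (_* sgn B) (*-comm (sgn A) (ε (length A))) ⟩
    (ε (length A) * sgn A) * sgn B
  ∎
  where
  open ≡-Reasoning
  ε-length : ∀ A → ε (length A) ≡ pow (- 1ℚ) (if null A then 0 else 1)
  ε-length []      = refl
  ε-length (_ ∷ _) = refl

sgn-invariant : RelabelInvariant sgn
sgn-invariant h h-mono σ = cong (pow (- 1ℚ)) (des-map h-mono σ)

downUp : List ℕ → ℚ
downUp σ = 𝟙 (isDownUp σ)

downUp-invariant : RelabelInvariant downUp
downUp-invariant h h-mono σ = cong 𝟙 (isDownUp-map h-mono σ)

downUp-split : ∀ A B → Above 1 A → Above 1 B →
  downUp (glue 1 A B) ≡ δ (length A) * δ (length B) + (oddᶜ (length A) * downUp A) * downUp B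
downUp-split []      []      _   _   = refl
downUp-split []      (b ∷ B) _   1<B = trans (cong 𝟙 (isDownUp-x∷ (b ∷ B) 1<B))
  (solve 1 (λ x → con 0ℚ := con 1ℚ :* con 0ℚ :+ (con 0ℚ :* con 1ℚ) :* x) refl (downUp (b ∷ B)))
downUp-split (a ∷ A) B       1<A 1<B = begin
    downUp (glue 1 (a ∷ A) B)
  ≡⟨ cong 𝟙 (isDownUp-split a A B 1<A 1<B) ⟩
    𝟙 (oddLength (a ∷ A) ∧ (isDownUp (a ∷ A) ∧ isDownUp B))
  ≡⟨ trans (if-∧ (oddLength (a ∷ A)) _ 1ℚ) (cong (𝟙 (oddLength (a ∷ A)) *_) (if-∧ (isDownUp (a ∷ A)) (isDownUp B) 1ℚ)) ⟩
    𝟙 (oddLength (a ∷ A)) * (downUp (a ∷ A) * downUp B)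
  ≡⟨ cong (_* (downUp (a ∷ A) * downUp B)) (oddᶜ-length (a ∷ A)) ⟨
    oddᶜ (length (a ∷ A)) * (downUp (a ∷ A) * downUp B)
  ≡⟨ solve 4 (λ o d e x → o :* (d :* e) := con 0ℚ :* x :+ (o :* d) :* e) refl
       (oddᶜ (length (a ∷ A))) (downUp (a ∷ A)) (downUp B) (δ (length B)) ⟩
    0ℚ * δ (length B) + (oddᶜ (length (a ∷ A)) * downUp (a ∷ A)) * downUp B
  ∎
  where open ≡-Reasoning

module WeightedSums (β : ℚ) where

  t : ℚ
  t = β * ½

  sgnLR sgnRL summand downUpRL : List ℕ → ℚ
  sgnLR σ    = sgn σ * pow t (LRmin σ)
  sgnRL σ    = sgn σ * pow t (RLmin σ)
  summand σ  = pow (- 1ℚ) (des σ) * pow (β * ½) (LRmin σ ℕ.+ RLmin σ ∸ 2)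
  downUpRL σ = if isDownUp σ then pow β (RLmin σ) else 0ℚ

  signedDes signedDesLR signedDesRL euler downUpRLSum : ℕ → ℚ
  signedDes n   = ∑ (arrangements n) sgn
  signedDesLR n = ∑ (arrangements n) sgnLR
  signedDesRL n = ∑ (arrangements n) sgnRL
  euler n       = ∑ (arrangements n) downUp
  downUpRLSum n = ∑ (arrangements n) downUpRL

  sgnLR-invariant : RelabelInvariant sgnLR
  sgnLR-invariant h h-mono σ = cong₂ _*_ (sgn-invariant h h-mono σ) (cong (pow t) (LRmin-map h-mono σ))

  sgnRL-invariant : RelabelInvariant sgnRL
  sgnRL-invariant h h-mono σ = cong₂ _*_ (sgn-invariant h h-mono σ) (cong (pow t) (RLmin-map h-mono σ))

  downUpRL-invariant : RelabelInvariant downUpRL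
  downUpRL-invariant h h-mono σ =
    cong₂ (λ b k → if b then pow β k else 0ℚ) (isDownUp-map h-mono σ) (RLmin-map h-mono σ)

  downUpRL-split : ∀ A B → Above 1 A → Above 1 B →
    downUpRL (glue 1 A B) ≡ δ (length A) * (δ (length B) * β) + (oddᶜ (length A) * downUp A) * (β * downUpRL B)
  downUpRL-split []      []      _   _   =
    solve 1 (λ b → b :* con 1ℚ := con 1ℚ :* (con 1ℚ :* b) :+ (con 0ℚ :* con 1ℚ) :* (b :* con 1ℚ)) refl β
  downUpRL-split []      (b ∷ B) _   1<B = trans
    (cong (λ z → if z then pow β (RLmin (1 ∷ b ∷ B)) else 0ℚ) (isDownUp-x∷ (b ∷ B) 1<B))
    (solve 2 (λ β x → con 0ℚ := con 1ℚ :* (con 0ℚ :* β) :+ (con 0ℚ :* con 1ℚ) :* (β :* x)) refl β (downUpRL (b ∷ B)))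
  downUpRL-split (a ∷ A) B       1<A 1<B = begin
      downUpRL (glue 1 (a ∷ A) B)
    ≡⟨ cong₂ (λ z k → if z then pow β k else 0ℚ) (isDownUp-split a A B 1<A 1<B) (RLmin-split (a ∷ A) B 1<A 1<B) ⟩
      (if oddLength (a ∷ A) ∧ (isDownUp (a ∷ A) ∧ isDownUp B) then β * pow β (RLmin B) else 0ℚ)
    ≡⟨ trans (if-∧ (oddLength (a ∷ A)) _ _) (cong (𝟙 (oddLength (a ∷ A)) *_)
         (trans (if-∧ (isDownUp (a ∷ A)) _ _) (cong (downUp (a ∷ A) *_) (if-* (isDownUp B) β _)))) ⟩
      𝟙 (oddLength (a ∷ A)) * (downUp (a ∷ A) * (β * downUpRL B))
    ≡⟨ cong (_* (downUp (a ∷ A) * (β * downUpRL B))) (oddᶜ-length (a ∷ A)) ⟨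
      oddᶜ (length (a ∷ A)) * (downUp (a ∷ A) * (β * downUpRL B))
    ≡⟨ solve 5 (λ o d β x y → o :* (d :* (β :* x)) := con 0ℚ :* y :+ (o :* d) :* (β :* x)) refl
         (oddᶜ (length (a ∷ A))) (downUp (a ∷ A)) β (downUpRL B) (δ (length B) * β) ⟩
      0ℚ * (δ (length B) * β) + (oddᶜ (length (a ∷ A)) * downUp (a ∷ A)) * (β * downUpRL B)
    ∎
    where open ≡-Reasoning

  private
    ε-sgn-invariant : RelabelInvariant (λ σ → ε (length σ) * sgn σ)
    ε-sgn-invariant = RelabelInvariant-* (RelabelInvariant-length ε) sgn-invariant

  signedDes-rec : ∀ n → signedDes (suc n) ≡ conv n (λ i j → (ε i * signedDes i) * signedDes j)
  signedDes-rec n = trans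
    (∑-arrangements-suc-factor n sgn (λ A → ε (length A) * sgn A) sgn ε-sgn-invariant sgn-invariant sgn-split)
    (conv-cong′ n _ _ (λ i j → cong (_* signedDes j) (∑-arrangements-length-* i ε sgn)))

  signedDesLR-rec : ∀ n → signedDesLR (suc n) ≡ conv n (λ i j → (t * (ε i * signedDesLR i)) * signedDes j)
  signedDesLR-rec n = trans
    (∑-arrangements-suc-factor n sgnLR (λ A → t * (ε (length A) * sgnLR A)) sgn
      (RelabelInvariant-* (RelabelInvariant-const t) (RelabelInvariant-* (RelabelInvariant-length ε) sgnLR-invariant))
      sgn-invariant factor)
    (conv-cong′ n _ _ (λ i j → cong (_* signedDes j)
      (trans (∑-*ˡ (arrangements i) _ t) (cong (t *_) (∑-arrangements-length-* i ε sgnLR)))))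
    where
    factor : ∀ A B → Above 1 A → Above 1 B → sgnLR (glue 1 A B) ≡ (t * (ε (length A) * sgnLR A)) * sgn B
    factor A B 1<A 1<B = trans (cong₂ _*_ (sgn-split A B 1<A 1<B) (cong (pow t) (LRmin-split A B 1<A 1<B)))
      (solve 5 (λ E S S′ t P → ((E :* S) :* S′) :* (t :* P) := (t :* (E :* (S :* P))) :* S′)
        refl (ε (length A)) (sgn A) (sgn B) t (pow t (LRmin A)))

  signedDesRL-rec : ∀ n → signedDesRL (suc n) ≡ conv n (λ i j → (ε i * signedDes i) * (t * signedDesRL j))
  signedDesRL-rec n = trans
    (∑-arrangements-suc-factor n sgnRL (λ A → ε (length A) * sgn A) (λ B → t * sgnRL B)
      ε-sgn-invariant (RelabelInvariant-* (RelabelInvariant-const t) sgnRL-invariant) factor)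
    (conv-cong′ n _ _ (λ i j → cong₂ _*_ (∑-arrangements-length-* i ε sgn) (∑-*ˡ (arrangements j) sgnRL t)))
    where
    factor : ∀ A B → Above 1 A → Above 1 B → sgnRL (glue 1 A B) ≡ (ε (length A) * sgn A) * (t * sgnRL B)
    factor A B 1<A 1<B = trans (cong₂ _*_ (sgn-split A B 1<A 1<B) (cong (pow t) (RLmin-split A B 1<A 1<B)))
      (solve 5 (λ E S S′ t P → ((E :* S) :* S′) :* (t :* P) := (E :* S) :* (t :* (S′ :* P)))
        refl (ε (length A)) (sgn A) (sgn B) t (pow t (RLmin B)))

  -- The statistic LRmin + RLmin − 2 splits as LRmin A + RLmin B: the letter 1 is counted by both.
  ∑-summand : ∀ n → ∑ (arrangements (suc n)) summand ≡ conv n (λ i j → (ε i * signedDesLR i) * signedDesRL j)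
  ∑-summand n = trans
    (∑-arrangements-suc-factor n summand (λ A → ε (length A) * sgnLR A) sgnRL
      (RelabelInvariant-* (RelabelInvariant-length ε) sgnLR-invariant) sgnRL-invariant factor)
    (conv-cong′ n _ _ (λ i j → cong (_* signedDesRL j) (∑-arrangements-length-* i ε sgnLR)))
    where
    factor : ∀ A B → Above 1 A → Above 1 B → summand (glue 1 A B) ≡ (ε (length A) * sgnLR A) * sgnRL B
    factor A B 1<A 1<B = trans
      (cong₂ _*_ (sgn-split A B 1<A 1<B) (trans
        (cong (pow t) (trans (cong₂ (λ l r → l ℕ.+ r ∸ 2) (LRmin-split A B 1<A 1<B) (RLmin-split A B 1<A 1<B))
                             (cong (_∸ 1) (ℕ.+-suc (LRmin A) (RLmin B)))))
        (pow-+ t (LRmin A) (RLmin B))))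
      (solve 5 (λ E S S′ P Q → ((E :* S) :* S′) :* (P :* Q) := (E :* (S :* P)) :* (S′ :* Q))
        refl (ε (length A)) (sgn A) (sgn B) (pow t (LRmin A)) (pow t (RLmin B)))

  euler-rec : ∀ n → euler (suc n) ≡ conv n (λ i j → δ i * δ j + (oddᶜ i * euler i) * euler j)
  euler-rec n = trans
    (∑-arrangements-suc-factor₂ n downUp (λ A → δ (length A)) (λ B → δ (length B)) (λ A → oddᶜ (length A) * downUp A) downUp
      (RelabelInvariant-length δ) (RelabelInvariant-length δ)
      (RelabelInvariant-* (RelabelInvariant-length oddᶜ) downUp-invariant) downUp-invariant downUp-split)
    (conv-cong′ n _ _ (λ i j → cong₂ _+_ (cong₂ _*_ (∑-arrangements-δ i) (∑-arrangements-δ j))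
                                         (cong (_* euler j) (∑-arrangements-length-* i oddᶜ downUp))))

  downUpRLSum-rec : ∀ n → downUpRLSum (suc n) ≡ conv n (λ i j → δ i * (δ j * β) + (oddᶜ i * euler i) * (β * downUpRLSum j))
  downUpRLSum-rec n = trans
    (∑-arrangements-suc-factor₂ n downUpRL (λ A → δ (length A)) (λ B → δ (length B) * β)
      (λ A → oddᶜ (length A) * downUp A) (λ B → β * downUpRL B)
      (RelabelInvariant-length δ) (RelabelInvariant-* (RelabelInvariant-length δ) (RelabelInvariant-const β))
      (RelabelInvariant-* (RelabelInvariant-length oddᶜ) downUp-invariant)
      (RelabelInvariant-* (RelabelInvariant-const β) downUpRL-invariant) downUpRL-split)
    (conv-cong′ n _ _ (λ i j → cong₂ _+_
      (cong₂ _*_ (∑-arrangements-δ i) (trans (∑-*ʳ (arrangements j) (λ B → δ (length B)) β) (cong (_* β) (∑-arrangements-δ j))))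
      (cong₂ _*_ (∑-arrangements-length-* i oddᶜ downUp) (∑-*ˡ (arrangements j) downUpRL β))))

  ∑-Perms-summand : ∀ n → ∑ (Perms (suc n)) summand ≡ cosᶜ n * downUpRLSum n
  ∑-Perms-summand n = begin
      ∑ (Perms (suc n)) summand
    ≡⟨ ∑-↭ summand (Perms↭arrangements (suc n)) ⟩
      ∑ (arrangements (suc n)) summand
    ≡⟨ ∑-summand n ⟩
      conv n (λ i j → (ε i * signedDesLR i) * signedDesRL j)
    ≡⟨ s≡cosᶜ*D n ⟩
      cosᶜ n * downUpRLSum n
    ∎
    where
    open ≡-Reasoning
    β≡t+t : β ≡ t + t
    β≡t+t = solve 1 (λ x → x := x :* con ½ :+ x :* con ½) refl β
    open CosineIdentity t β β≡t+t signedDes euler signedDesLR signedDesRL downUpRLSum refl refl refl refl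
      signedDes-rec euler-rec signedDesLR-rec signedDesRL-rec downUpRLSum-rec

  ∑-DownUpPerms : ∀ m → ∑ (DownUpPerms m) (λ σ → pow β (RLmin σ)) ≡ downUpRLSum m
  ∑-DownUpPerms m = trans (∑-filter isDownUp (Perms m) (λ σ → pow β (RLmin σ))) (∑-↭ downUpRL (Perms↭arrangements m))

cosᶜ-even : ∀ k → cosᶜ (2 ℕ.* k) ≡ pow (- 1ℚ) k
cosᶜ-even zero    = refl
cosᶜ-even (suc k) = trans (cong cosᶜ (ℕ.*-suc 2 k))
  (trans (cong -_ (cosᶜ-even k)) (solve 1 (λ p → :- p := con (- 1ℚ) :* p) refl (pow (- 1ℚ) k)))

cosᶜ-odd : ∀ k → cosᶜ (suc (2 ℕ.* k)) ≡ 0ℚ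
cosᶜ-odd zero    = refl
cosᶜ-odd (suc k) = trans (cong (cosᶜ ∘ suc) (ℕ.*-suc 2 k)) (cong -_ (cosᶜ-odd k))

mainTheorem8 : (β : ℚ) →
    ((k : ℕ) → k ≥ 1 →
      ∑ (Perms (ℕ.suc (2 ℕ.* k))) (λ σ → pow (- 1ℚ) (des σ) * pow (β * ½) (LRmin σ ℕ.+ RLmin σ ∸ 2))
        ≡ pow (- 1ℚ) k * ∑ (DownUpPerms (2 ℕ.* k)) (λ σ → pow β (RLmin σ)))
    × ((k : ℕ) →
      ∑ (Perms (ℕ.suc (ℕ.suc (2 ℕ.* k)))) (λ σ → pow (- 1ℚ) (des σ) * pow (β * ½) (LRmin σ ℕ.+ RLmin σ ∸ 2))
        ≡ 0ℚ)
mainTheorem8 β = even , odd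
  where
  open WeightedSums β
  even : ∀ k → k ≥ 1 → ∑ (Perms (suc (2 ℕ.* k))) summand ≡ pow (- 1ℚ) k * ∑ (DownUpPerms (2 ℕ.* k)) (λ σ → pow β (RLmin σ))
  even k _ = trans (∑-Perms-summand (2 ℕ.* k)) (cong₂ _*_ (cosᶜ-even k) (sym (∑-DownUpPerms (2 ℕ.* k))))
  odd : ∀ k → ∑ (Perms (suc (suc (2 ℕ.* k)))) summand ≡ 0ℚ
  odd k = trans (∑-Perms-summand (suc (2 ℕ.* k)))
    (trans (cong (_* downUpRLSum (suc (2 ℕ.* k))) (cosᶜ-odd k)) (*-zeroˡ (downUpRLSum (suc (2 ℕ.* k)))))
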